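{- Let $p\ge3$ be prime and $G=E_p(p^3)=\langle a,b,c\mid a^p=b^p=c^p=1,[b,a]=c,[c,a]=1,[c,b]=1\rangle$. Consider the following $2p+5$ subgroups of $G$ (representatives of the conjugacy classes of subgroups): $\{1\}$; $Z(G)=\langle c\rangle$; $H_i=\langle ab^i\rangle$ $(0\le i\le p-1)$, $H_p=\langle b\rangle$; $H'_i=\langle ab^i,c\rangle$ $(0\le i\le p-1)$, $H'_p=\langle b,c\rangle$; and $G$. Then $H^2(G,\mathbb{Q}/\mathbb{Z})=\langle\overline{f_1},\overline{f_2}\rangle\simeq(\mathbb{Z}/p\mathbb{Z})^{\oplus2}$ and $$\mathrm{Ker}\{H^2(G,\mathbb{Q}/\mathbb{Z})\xrightarrow{\mathrm{res}}H^2(H',\mathbb{Q}/\mathbb{Z})\}=\begin{cases}\langle\overline{f_1},\overline{f_2}\rangle & H'=\{1\},Z(G),H_i\ (0\le i\le p),\\ \langle\overline{f_2}\rangle\simeq\mathbb{Z}/p\mathbb{Z} & H'=H'_0,\\ \langle\overline{f_1}\,\overline{f_2}^{\,-i^{ -1}}\rangle\simeq\mathbb{Z}/p\mathbb{Z} & H'=H'_i\ (1\le i\le p-1),\\ \langle\overline{f_1}\rangle\simeq\mathbb{Z}/p\mathbb{Z} & H'=H'_p,\\ 0 & H'=G,\end{cases}$$ where $i^{ -1}$ denotes the inverse of $i$ modulo $p$.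
   Context: $[x,y]=x^{ -1}y^{ -1}xy$; each $g\in G$ is uniquely $a^sb^tc^u$ with $0\le s,t,u\le p-1$. The 2-cocycles $f_1,f_2:G\times G\to\mathbb{Q}/\mathbb{Z}$ are $f_1(a^{s_1}b^{t_1}c^{u_1},a^{s_2}b^{t_2}c^{u_2})=\big(u_1s_2+t_1\frac{s_2(s_2-1)}{2}\big)/p$ and $f_2(a^{s_1}b^{t_1}c^{u_1},a^{s_2}b^{t_2}c^{u_2})=\big(\frac{t_1(t_1-1)}{2}s_2+(t_1s_2+u_1)t_2\big)/p$; $\overline{f_1},\overline{f_2}$ are their cohomology classes, and the group $H^2(G,\mathbb{Q}/\mathbb{Z})$ is written multiplicatively. -}

module Defs where

open import Data.Nat as ℕ using (ℕ; NonZero; _∸_)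
open import Data.Nat.DivMod using (_mod_)
open import Data.Fin using (Fin; toℕ)
open import Data.Integer as ℤ using (ℤ; +_)
open import Data.Rational as ℚ using (ℚ)
open import Data.Product using (_×_; _,_; ∃; ∃-syntax; Σ-syntax)
open import Data.List using (List; []; _∷_)
open import Data.List.Membership.Propositional using (_∈_)
open import Relation.Binary.PropositionalEquality using (_≡_)

-- Concrete model of G = E_p(p^3): the element a^s b^t c^u is the triple (s , t , u),
-- 0 ≤ s,t,u ≤ p-1.  From [b,a] = b⁻¹a⁻¹ba = c (c central) we get b^t a^s = a^s b^t c^(ts), so
-- (a^s1 b^t1 c^u1)(a^s2 b^t2 c^u2) = a^(s1+s2) b^(t1+t2) c^(u1+u2+t1 s2).
module _ (p : ℕ) .{{_ : NonZero p}} where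

  G : Set
  G = Fin p × Fin p × Fin p

  infixl 7 _·_
  _·_ : G → G → G
  (s₁ , t₁ , u₁) · (s₂ , t₂ , u₂) =
    ((toℕ s₁ ℕ.+ toℕ s₂) mod p) ,
    ((toℕ t₁ ℕ.+ toℕ t₂) mod p) ,
    ((toℕ u₁ ℕ.+ toℕ u₂ ℕ.+ toℕ t₁ ℕ.* toℕ s₂) mod p)

  e : G
  e = (0 mod p) , (0 mod p) , (0 mod p)

  inv : G → G
  inv (s , t , u) =
    ((p ∸ toℕ s) mod p) , ((p ∸ toℕ t) mod p) ,
    (((p ∸ toℕ u) ℕ.+ toℕ t ℕ.* toℕ s) mod p)

  gen-a gen-b gen-c : G
  gen-a = (1 mod p) , (0 mod p) , (0 mod p)
  gen-b = (0 mod p) , (1 mod p) , (0 mod p)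
  gen-c = (0 mod p) , (0 mod p) , (1 mod p)

  _^ᴳ_ : G → ℕ → G
  g ^ᴳ ℕ.zero = e
  g ^ᴳ ℕ.suc n = g · (g ^ᴳ n)

  data ⟪_⟫ (S : List G) : G → Set where
    base : ∀ {g} → g ∈ S → ⟪ S ⟫ g
    one  : ⟪ S ⟫ e
    mul  : ∀ {g h} → ⟪ S ⟫ g → ⟪ S ⟫ h → ⟪ S ⟫ (g · h)
    inv′ : ∀ {g} → ⟪ S ⟫ g → ⟪ S ⟫ (inv g)

  infix 4 _≈ℚ/ℤ_
  _≈ℚ/ℤ_ : ℚ → ℚ → Set
  x ≈ℚ/ℤ y = Σ[ z ∈ ℤ ] (x ℚ.- y ≡ z ℚ./ 1)

  -- 2-cochains G × G → Q/Z (represented by ℚ-valued functions, compared modulo ℤ)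
  C² : Set
  C² = G → G → ℚ

  -- additive notation for the (multiplicatively written) group of cochains
  _⊕_ : C² → C² → C²
  (f ⊕ g) x y = f x y ℚ.+ g x y

  _⊙_ : ℤ → C² → C²
  (k ⊙ f) x y = (k ℚ./ 1) ℚ.* f x y

  zeroC : C²
  zeroC x y = ℚ.0ℚ

  IsCocycle : C² → Set
  IsCocycle f = ∀ g h k → f h k ℚ.+ f g (h · k) ≈ℚ/ℤ f (g · h) k ℚ.+ f g h

  CoboundaryOn : (G → Set) → C² → Set
  CoboundaryOn H f = Σ[ φ ∈ (G → ℚ) ] (∀ g h → H g → H h →
    f g h ≈ℚ/ℤ φ g ℚ.+ φ h ℚ.- φ (g · h))

  IsCoboundary : C² → Set
  IsCoboundary f = Σ[ φ ∈ (G → ℚ) ] (∀ g h → f g h ≈ℚ/ℤ φ g ℚ.+ φ h ℚ.- φ (g · h))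

  InCyclic : C² → C² → Set
  InCyclic h f = Σ[ k ∈ ℤ ] IsCoboundary (f ⊕ ((ℤ.- k) ⊙ h))

  InSpan₂ : C² → C² → C² → Set
  InSpan₂ h₁ h₂ f = Σ[ x ∈ ℤ ] Σ[ y ∈ ℤ ] IsCoboundary (f ⊕ (((ℤ.- x) ⊙ h₁) ⊕ ((ℤ.- y) ⊙ h₂)))

  -- Ker (res : H²(G,Q/Z) → H²(H,Q/Z)) equals the set of classes satisfying P
  KernelIs : (G → Set) → (C² → Set) → Set
  KernelIs H P = ∀ f → IsCocycle f → (CoboundaryOn H f → P f) × (P f → CoboundaryOn H f)

  private
    n/p : ℕ → ℚ
    n/p n = (+ n) ℚ./ p

  f₁ : C²
  f₁ (s₁ , t₁ , u₁) (s₂ , t₂ , u₂) =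
    n/p (toℕ u₁ ℕ.* toℕ s₂ ℕ.+ toℕ t₁ ℕ.* ((toℕ s₂ ℕ.* (toℕ s₂ ∸ 1)) ℕ./ 2))

  f₂ : C²
  f₂ (s₁ , t₁ , u₁) (s₂ , t₂ , u₂) =
    n/p (((toℕ t₁ ℕ.* (toℕ t₁ ∸ 1)) ℕ./ 2) ℕ.* toℕ s₂
         ℕ.+ (toℕ t₁ ℕ.* toℕ s₂ ℕ.+ toℕ u₁) ℕ.* toℕ t₂)

  Triv Z H′G : G → Set
  Triv = ⟪ [] ⟫
  Z    = ⟪ gen-c ∷ [] ⟫
  H′G  = ⟪ gen-a ∷ gen-b ∷ gen-c ∷ [] ⟫

  Hc : ℕ → G → Set
  Hc i = ⟪ (gen-a · (gen-b ^ᴳ i)) ∷ [] ⟫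
  Hp : G → Set
  Hp = ⟪ gen-b ∷ [] ⟫

  H′c : ℕ → G → Set
  H′c i = ⟪ (gen-a · (gen-b ^ᴳ i)) ∷ gen-c ∷ [] ⟫
  H′p : G → Set
  H′p = ⟪ gen-b ∷ gen-c ∷ [] ⟫

{-# OPTIONS --safe #-}
module Submission where

-- A 2-cocycle f defines the central extension E = G × ℚ/ℤ with (g , x) (h , y) = (g h , x + y + f g h),
-- and f is a coboundary on a subgroup H exactly when the projection E → G has a multiplicative section
-- over H.  As c is central, bracket f g = f c g - f g c is the commutator of lifts of c and g: it is
-- additive in g, vanishes on coboundaries, and equals s/p for f₁ and t/p for f₂ at g = a^s b^t c^u.
-- Conversely, if the brackets of f at a and b vanish, lifts of a and b of order p together with their
-- commutator multiply exactly like a, b and c, which gives a section over G.  Subtracting a suitable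
-- x f₁ + y f₂ from any cocycle kills both brackets, so H² is spanned by f̄₁ and f̄₂, and x f̄₁ + y f̄₂
-- vanishes iff p divides x and y.  Commuting lifts give sections over every cyclic subgroup and over
-- ⟨g , c⟩ when bracket f g = 0, and the kernels of the restrictions follow by linear algebra mod p.

open import Algebra.Bundles using (Monoid)
open import Data.Nat using (ℕ; NonZero)
open import Data.Nat.Divisibility using () renaming (_∣_ to _∣ℕ_)
open import Defs hiding (_⊕_; _⊙_; _^ᴳ_; Z)

module Choose₂ where

  open import Data.Empty using (⊥-elim)
  open import Data.Nat as ℕ using (zero; suc; _+_; _*_; _∸_; _%_; _≤_)
  open import Data.Nat.Properties using (+-identityʳ; *-distribʳ-+; *-cancelʳ-≡)
  open import Data.Nat.DivMod using (m≡m%n+[m/n]*n; m*n/n≡m; m%n<n)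
  open import Data.Nat.Divisibility using (_∣_; divides; hasNonTrivialDivisor)
  open import Data.Nat.Primality using (Prime)
  open import Data.Nat.Tactic.RingSolver using (solve-∀)
  open import Relation.Binary.PropositionalEquality using (_≡_; refl; sym; trans; cong; module ≡-Reasoning)

  choose₂ : ℕ → ℕ
  choose₂ zero    = 0
  choose₂ (suc n) = choose₂ n + n

  choose₂-+ : ∀ m n → choose₂ (m + n) ≡ choose₂ m + choose₂ n + m * n
  choose₂-+ zero    n = sym (+-identityʳ (choose₂ n))
  choose₂-+ (suc m) n = begin
    choose₂ (m + n) + (m + n)                       ≡⟨ cong (_+ (m + n)) (choose₂-+ m n) ⟩
    choose₂ m + choose₂ n + m * n + (m + n)         ≡⟨ rearrange (choose₂ m) (choose₂ n) m n ⟩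
    choose₂ m + m + choose₂ n + suc m * n           ∎
    where
    open ≡-Reasoning
    rearrange : ∀ a b m n → a + b + m * n + (m + n) ≡ a + m + b + suc m * n
    rearrange = solve-∀

  choose₂*2 : ∀ n → choose₂ n * 2 ≡ n * (n ∸ 1)
  choose₂*2 zero          = refl
  choose₂*2 (suc zero)    = refl
  choose₂*2 (suc (suc n)) = begin
    (choose₂ (suc n) + suc n) * 2     ≡⟨ *-distribʳ-+ 2 (choose₂ (suc n)) (suc n) ⟩
    choose₂ (suc n) * 2 + suc n * 2   ≡⟨ cong (_+ suc n * 2) (choose₂*2 (suc n)) ⟩
    suc n * n + suc n * 2             ≡⟨ rearrange n ⟩
    suc (suc n) * suc n               ∎
    where
    open ≡-Reasoning
    rearrange : ∀ n → (1 + n) * n + (1 + n) * 2 ≡ (2 + n) * (1 + n)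
    rearrange = solve-∀

  n[n∸1]/2≡choose₂ : ∀ n → (n * (n ∸ 1)) ℕ./ 2 ≡ choose₂ n
  n[n∸1]/2≡choose₂ n = trans (cong (ℕ._/ 2) (sym (choose₂*2 n))) (m*n/n≡m (choose₂ n) 2)

  odd⇒∣choose₂ : ∀ {n} → n % 2 ≡ 1 → n ∣ choose₂ n
  odd⇒∣choose₂ {n} n%2≡1 = divides (n ℕ./ 2) (*-cancelʳ-≡ (choose₂ n) _ 2 (begin
    choose₂ n * 2               ≡⟨ choose₂*2 n ⟩
    n * (n ∸ 1)                 ≡⟨ cong (λ m → n * (m ∸ 1)) (m≡m%n+[m/n]*n n 2) ⟩
    n * (n % 2 + n ℕ./ 2 * 2 ∸ 1) ≡⟨ cong (λ r → n * (r + n ℕ./ 2 * 2 ∸ 1)) n%2≡1 ⟩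
    n * (n ℕ./ 2 * 2)           ≡⟨ rearrange n (n ℕ./ 2) ⟩
    n ℕ./ 2 * n * 2             ∎))
    where
    open ≡-Reasoning
    rearrange : ∀ n q → n * (q * 2) ≡ q * n * 2
    rearrange = solve-∀

  prime⇒odd : ∀ {p} → Prime p → 3 ≤ p → p % 2 ≡ 1
  prime⇒odd {p} pr 3≤p with p % 2 | m%n<n p 2 | m≡m%n+[m/n]*n p 2
  ... | 0 | _ | p≡[p/2]*2 = ⊥-elim (Prime.notComposite pr (hasNonTrivialDivisor {divisor = 2} 3≤p (divides (p ℕ./ 2) p≡[p/2]*2)))
  ... | 1 | _ | _ = refl
  ... | suc (suc _) | ℕ.s≤s (ℕ.s≤s ()) | _

open Choose₂

module ModularArithmetic (p : ℕ) .{{_ : NonZero p}} where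

  open import Data.Fin using (toℕ)
  open import Data.Fin.Properties using (toℕ-fromℕ<)
  open import Data.Nat as ℕ using (zero; suc; _+_; _*_; _%_; _<_)
  open import Data.Nat.Properties using (+-identityʳ; *-comm)
  open import Data.Nat.DivMod using (_mod_; m≡m%n+[m/n]*n; %-distribˡ-+; %-distribˡ-*; m%n%n≡m%n; [m+kn]%n≡m%n; m<n⇒m%n≡m; m%n<n)
  open import Data.Nat.Divisibility using (n∣m⇒m%n≡0)
  open import Data.Nat.Tactic.RingSolver using (solve-∀)
  open import Relation.Binary.PropositionalEquality using (_≡_; refl; sym; trans; cong; cong₂; module ≡-Reasoning)

  infix 4 _≡ₚ_
  _≡ₚ_ : ℕ → ℕ → Set
  m ≡ₚ n = m % p ≡ n % p

  ≡ₚ-refl : ∀ m → m ≡ₚ m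
  ≡ₚ-refl m = refl

  ≡⇒≡ₚ : ∀ {m n} → m ≡ n → m ≡ₚ n
  ≡⇒≡ₚ = cong (_% p)

  +-congₚ : ∀ {m m′ n n′} → m ≡ₚ m′ → n ≡ₚ n′ → m + n ≡ₚ m′ + n′
  +-congₚ {m} {m′} {n} {n′} m≡m′ n≡n′ = begin
    (m + n) % p               ≡⟨ %-distribˡ-+ m n p ⟩
    (m % p + n % p) % p       ≡⟨ cong₂ (λ a b → (a + b) % p) m≡m′ n≡n′ ⟩
    (m′ % p + n′ % p) % p     ≡⟨ %-distribˡ-+ m′ n′ p ⟨
    (m′ + n′) % p             ∎
    where open ≡-Reasoning

  *-congₚ : ∀ {m m′ n n′} → m ≡ₚ m′ → n ≡ₚ n′ → m * n ≡ₚ m′ * n′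
  *-congₚ {m} {m′} {n} {n′} m≡m′ n≡n′ = begin
    (m * n) % p               ≡⟨ %-distribˡ-* m n p ⟩
    (m % p * (n % p)) % p     ≡⟨ cong₂ (λ a b → (a * b) % p) m≡m′ n≡n′ ⟩
    (m′ % p * (n′ % p)) % p   ≡⟨ %-distribˡ-* m′ n′ p ⟨
    (m′ * n′) % p             ∎
    where open ≡-Reasoning

  %≡ₚ : ∀ m → m % p ≡ₚ m
  %≡ₚ m = m%n%n≡m%n m p

  toℕ-mod≡ₚ : ∀ m → toℕ (m mod p) ≡ₚ m
  toℕ-mod≡ₚ m = trans (cong (_% p) (toℕ-fromℕ< (m%n<n m p))) (%≡ₚ m)

  +*p≡ₚ : ∀ m k → m + k * p ≡ₚ m
  +*p≡ₚ m k = [m+kn]%n≡m%n m k p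

  *p≡ₚ0 : ∀ k → k * p ≡ₚ 0
  *p≡ₚ0 k = +*p≡ₚ 0 k

  p*≡ₚ0 : ∀ k → p * k ≡ₚ 0
  p*≡ₚ0 k = trans (≡⇒≡ₚ (*-comm p k)) (*p≡ₚ0 k)

  p≡ₚ0 : p ≡ₚ 0
  p≡ₚ0 = trans (≡⇒≡ₚ (sym (+-identityʳ p))) (*p≡ₚ0 1)

  ≡ₚ⇒≡ : ∀ {m n} → m < p → n < p → m ≡ₚ n → m ≡ n
  ≡ₚ⇒≡ m<p n<p m≡n = trans (sym (m<n⇒m%n≡m m<p)) (trans m≡n (m<n⇒m%n≡m n<p))

  module _ (p∣choose₂p : p ∣ℕ choose₂ p) where

    choose₂-*p≡ₚ0 : ∀ k → choose₂ (k * p) ≡ₚ 0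
    choose₂-*p≡ₚ0 zero    = refl
    choose₂-*p≡ₚ0 (suc k) = begin
      choose₂ (p + k * p) % p                                ≡⟨ ≡⇒≡ₚ (choose₂-+ p (k * p)) ⟩
      (choose₂ p + choose₂ (k * p) + p * (k * p)) % p        ≡⟨ +-congₚ (+-congₚ choose₂p≡ₚ0 (choose₂-*p≡ₚ0 k)) (p*≡ₚ0 (k * p)) ⟩
      0 % p                                                  ∎
      where
      open ≡-Reasoning
      choose₂p≡ₚ0 : choose₂ p ≡ₚ 0
      choose₂p≡ₚ0 = trans (n∣m⇒m%n≡0 _ p p∣choose₂p) (sym (m<n⇒m%n≡m (ℕ.>-nonZero⁻¹ p)))

    choose₂-congₚ : ∀ {m n} → m ≡ₚ n → choose₂ m ≡ₚ choose₂ n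
    choose₂-congₚ {m} {n} m≡n = trans (sym (choose₂-% m)) (trans (cong (λ r → choose₂ r % p) m≡n) (choose₂-% n))
      where
      choose₂-% : ∀ m → choose₂ (m % p) ≡ₚ choose₂ m
      choose₂-% m = sym (begin
        choose₂ m % p
          ≡⟨ cong (λ r → choose₂ r % p) (m≡m%n+[m/n]*n m p) ⟩
        choose₂ (m % p + k * p) % p
          ≡⟨ ≡⇒≡ₚ (choose₂-+ (m % p) (k * p)) ⟩
        (choose₂ (m % p) + choose₂ (k * p) + m % p * (k * p)) % p
          ≡⟨ +-congₚ (+-congₚ (≡ₚ-refl (choose₂ (m % p))) (choose₂-*p≡ₚ0 k)) (*-congₚ (≡ₚ-refl (m % p)) (*p≡ₚ0 k)) ⟩
        (choose₂ (m % p) + 0 + m % p * 0) % p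
          ≡⟨ ≡⇒≡ₚ (cancel (choose₂ (m % p)) (m % p)) ⟩
        choose₂ (m % p) % p                                        ∎)
        where
        open ≡-Reasoning
        k : ℕ
        k = m ℕ./ p
        cancel : ∀ a b → a + 0 + b * 0 ≡ a
        cancel = solve-∀

module MonoidPowers {ℓ₁ ℓ₂} (M : Monoid ℓ₁ ℓ₂) where

  open import Data.Nat as ℕ using (zero; suc; _+_; _*_; _%_)
  open import Data.Nat.Properties using (*-suc; *-zeroʳ; +-comm)
  open import Data.Nat.DivMod using (m≡m%n+[m/n]*n)
  open import Relation.Binary.PropositionalEquality as ≡ using (_≡_)

  open Monoid M
  open import Algebra.Definitions.RawMonoid rawMonoid using (_×_)
  open import Algebra.Properties.Monoid.Mult M using (×-homo-+; ×-congˡ)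
  open import Algebra.Solver.Monoid M using (solve; _⊜_) renaming (_⊕_ to _⊕′_)
  open import Relation.Binary.Reasoning.Setoid setoid

  infixr 8 _^_
  _^_ : Carrier → ℕ → Carrier
  x ^ n = n × x

  ^-+ : ∀ x m n → x ^ (m + n) ≈ x ^ m ∙ x ^ n
  ^-+ x m n = ×-homo-+ x m n

  ^-≡ : ∀ x {m n} → m ≡ n → x ^ m ≈ x ^ n
  ^-≡ x = ×-congˡ

  ^-*-ε : ∀ {x} p → x ^ p ≈ ε → ∀ k → x ^ (k * p) ≈ ε
  ^-*-ε {x} p xᵖ≈ε zero    = refl
  ^-*-ε {x} p xᵖ≈ε (suc k) = begin
    x ^ (p + k * p)      ≈⟨ ^-+ x p (k * p) ⟩
    x ^ p ∙ x ^ (k * p)  ≈⟨ ∙-cong xᵖ≈ε (^-*-ε p xᵖ≈ε k) ⟩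
    ε ∙ ε                ≈⟨ identityˡ ε ⟩
    ε                    ∎

  ^-% : ∀ {x} p .{{_ : NonZero p}} → x ^ p ≈ ε → ∀ n → x ^ n ≈ x ^ (n % p)
  ^-% {x} p xᵖ≈ε n = begin
    x ^ n                                ≈⟨ ^-≡ x (m≡m%n+[m/n]*n n p) ⟩
    x ^ (n % p + n ℕ./ p * p)            ≈⟨ ^-+ x (n % p) (n ℕ./ p * p) ⟩
    x ^ (n % p) ∙ x ^ (n ℕ./ p * p)      ≈⟨ ∙-cong refl (^-*-ε p xᵖ≈ε (n ℕ./ p)) ⟩
    x ^ (n % p) ∙ ε                      ≈⟨ identityʳ _ ⟩
    x ^ (n % p)                          ∎

  ^-cong-% : ∀ {x} p .{{_ : NonZero p}} → x ^ p ≈ ε → ∀ {m n} → m % p ≡ n % p → x ^ m ≈ x ^ n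
  ^-cong-% {x} p xᵖ≈ε {m} {n} m≡n = begin
    x ^ m          ≈⟨ ^-% p xᵖ≈ε m ⟩
    x ^ (m % p)    ≈⟨ ^-≡ x m≡n ⟩
    x ^ (n % p)    ≈⟨ ^-% p xᵖ≈ε n ⟨
    x ^ n          ∎

  Commute : Carrier → Carrier → Set ℓ₂
  Commute x y = x ∙ y ≈ y ∙ x

  commute-^ʳ : ∀ {x y} → Commute x y → ∀ n → Commute x (y ^ n)
  commute-^ʳ {x} {y} xy≈yx zero    = trans (identityʳ x) (sym (identityˡ x))
  commute-^ʳ {x} {y} xy≈yx (suc n) = begin
    x ∙ (y ∙ y ^ n)    ≈⟨ assoc x y (y ^ n) ⟨
    (x ∙ y) ∙ y ^ n    ≈⟨ ∙-cong xy≈yx refl ⟩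
    (y ∙ x) ∙ y ^ n    ≈⟨ assoc y x (y ^ n) ⟩
    y ∙ (x ∙ y ^ n)    ≈⟨ ∙-cong refl (commute-^ʳ xy≈yx n) ⟩
    y ∙ (y ^ n ∙ x)    ≈⟨ assoc y (y ^ n) x ⟨
    (y ∙ y ^ n) ∙ x    ∎

  commute-^ : ∀ {x y} → Commute x y → ∀ m n → Commute (x ^ m) (y ^ n)
  commute-^ xy≈yx m n = sym (commute-^ʳ (sym (commute-^ʳ xy≈yx n)) m)

  commuting-words : ∀ {x y} → Commute x y → ∀ M N M′ N′ →
                    (x ^ M ∙ y ^ N) ∙ (x ^ M′ ∙ y ^ N′) ≈ x ^ (M + M′) ∙ y ^ (N + N′)
  commuting-words {x} {y} xy≈yx M N M′ N′ = begin
    (x ^ M ∙ y ^ N) ∙ (x ^ M′ ∙ y ^ N′)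
      ≈⟨ solve 4 (λ a b c d → (a ⊕′ b) ⊕′ (c ⊕′ d) ⊜ a ⊕′ ((b ⊕′ c) ⊕′ d)) refl (x ^ M) (y ^ N) (x ^ M′) (y ^ N′) ⟩
    x ^ M ∙ ((y ^ N ∙ x ^ M′) ∙ y ^ N′)
      ≈⟨ ∙-cong refl (∙-cong (commute-^ (sym xy≈yx) N M′) refl) ⟩
    x ^ M ∙ ((x ^ M′ ∙ y ^ N) ∙ y ^ N′)
      ≈⟨ solve 4 (λ a b c d → a ⊕′ ((b ⊕′ c) ⊕′ d) ⊜ (a ⊕′ b) ⊕′ (c ⊕′ d)) refl (x ^ M) (x ^ M′) (y ^ N) (y ^ N′) ⟩
    (x ^ M ∙ x ^ M′) ∙ (y ^ N ∙ y ^ N′)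
      ≈⟨ ∙-cong (^-+ x M M′) (^-+ y N N′) ⟨
    x ^ (M + M′) ∙ y ^ (N + N′)            ∎

  module HeisenbergWords (x y z : Carrier) (κ : ℕ) (zx : Commute z x) (zy : Commute z y)
                         (yx : y ∙ x ≈ (x ∙ y) ∙ z ^ κ) where

    y∙x^ : ∀ m → y ∙ x ^ m ≈ (x ^ m ∙ y) ∙ z ^ (κ * m)
    y∙x^ zero = begin
      y ∙ ε                    ≈⟨ identityʳ y ⟩
      y                        ≈⟨ identityˡ y ⟨
      ε ∙ y                    ≈⟨ identityʳ _ ⟨
      (ε ∙ y) ∙ ε              ≈⟨ ∙-cong refl (^-≡ z (*-zeroʳ κ)) ⟨
      (ε ∙ y) ∙ z ^ (κ * 0)    ∎
    y∙x^ (suc m) = begin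
      y ∙ (x ∙ x ^ m)
        ≈⟨ assoc y x (x ^ m) ⟨
      (y ∙ x) ∙ x ^ m
        ≈⟨ ∙-cong yx refl ⟩
      ((x ∙ y) ∙ z ^ κ) ∙ x ^ m
        ≈⟨ solve 4 (λ a b c d → ((a ⊕′ b) ⊕′ c) ⊕′ d ⊜ a ⊕′ (b ⊕′ (c ⊕′ d))) refl x y (z ^ κ) (x ^ m) ⟩
      x ∙ (y ∙ (z ^ κ ∙ x ^ m))
        ≈⟨ ∙-cong refl (∙-cong refl (commute-^ zx κ m)) ⟩
      x ∙ (y ∙ (x ^ m ∙ z ^ κ))
        ≈⟨ ∙-cong refl (assoc y (x ^ m) (z ^ κ)) ⟨
      x ∙ ((y ∙ x ^ m) ∙ z ^ κ)
        ≈⟨ ∙-cong refl (∙-cong (y∙x^ m) refl) ⟩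
      x ∙ (((x ^ m ∙ y) ∙ z ^ (κ * m)) ∙ z ^ κ)
        ≈⟨ solve 5 (λ a b c d e → a ⊕′ (((b ⊕′ c) ⊕′ d) ⊕′ e) ⊜ ((a ⊕′ b) ⊕′ c) ⊕′ (d ⊕′ e)) refl x (x ^ m) y (z ^ (κ * m)) (z ^ κ) ⟩
      ((x ∙ x ^ m) ∙ y) ∙ (z ^ (κ * m) ∙ z ^ κ)
        ≈⟨ ∙-cong refl (^-+ z (κ * m) κ) ⟨
      ((x ∙ x ^ m) ∙ y) ∙ z ^ (κ * m + κ)
        ≈⟨ ∙-cong refl (^-≡ z (≡.trans (+-comm (κ * m) κ) (≡.sym (*-suc κ m)))) ⟩
      ((x ∙ x ^ m) ∙ y) ∙ z ^ (κ * suc m)        ∎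

    y^∙x^ : ∀ n m → y ^ n ∙ x ^ m ≈ (x ^ m ∙ y ^ n) ∙ z ^ (n * (κ * m))
    y^∙x^ zero m = begin
      ε ∙ x ^ m              ≈⟨ identityˡ _ ⟩
      x ^ m                  ≈⟨ identityʳ _ ⟨
      x ^ m ∙ ε              ≈⟨ identityʳ _ ⟨
      (x ^ m ∙ ε) ∙ ε        ∎
    y^∙x^ (suc n) m = begin
      (y ∙ y ^ n) ∙ x ^ m
        ≈⟨ assoc y (y ^ n) (x ^ m) ⟩
      y ∙ (y ^ n ∙ x ^ m)
        ≈⟨ ∙-cong refl (y^∙x^ n m) ⟩
      y ∙ ((x ^ m ∙ y ^ n) ∙ z ^ k)
        ≈⟨ solve 4 (λ a b c d → a ⊕′ ((b ⊕′ c) ⊕′ d) ⊜ (a ⊕′ b) ⊕′ (c ⊕′ d)) refl y (x ^ m) (y ^ n) (z ^ k) ⟩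
      (y ∙ x ^ m) ∙ (y ^ n ∙ z ^ k)
        ≈⟨ ∙-cong (y∙x^ m) refl ⟩
      ((x ^ m ∙ y) ∙ z ^ l) ∙ (y ^ n ∙ z ^ k)
        ≈⟨ solve 5 (λ a b c d e → ((a ⊕′ b) ⊕′ c) ⊕′ (d ⊕′ e) ⊜ (a ⊕′ b) ⊕′ ((c ⊕′ d) ⊕′ e)) refl (x ^ m) y (z ^ l) (y ^ n) (z ^ k) ⟩
      (x ^ m ∙ y) ∙ ((z ^ l ∙ y ^ n) ∙ z ^ k)
        ≈⟨ ∙-cong refl (∙-cong (commute-^ zy l n) refl) ⟩
      (x ^ m ∙ y) ∙ ((y ^ n ∙ z ^ l) ∙ z ^ k)
        ≈⟨ solve 5 (λ a b c d e → (a ⊕′ b) ⊕′ ((c ⊕′ d) ⊕′ e) ⊜ (a ⊕′ (b ⊕′ c)) ⊕′ (d ⊕′ e)) refl (x ^ m) y (y ^ n) (z ^ l) (z ^ k) ⟩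
      (x ^ m ∙ (y ∙ y ^ n)) ∙ (z ^ l ∙ z ^ k)
        ≈⟨ ∙-cong refl (^-+ z l k) ⟨
      (x ^ m ∙ (y ∙ y ^ n)) ∙ z ^ (l + k)          ∎
      where
      k l : ℕ
      k = n * (κ * m)
      l = κ * m

    word : ℕ → ℕ → ℕ → Carrier
    word M N O = (x ^ M ∙ y ^ N) ∙ z ^ O

    word-∙ : ∀ M N O M′ N′ O′ →
             word M N O ∙ word M′ N′ O′ ≈ word (M + M′) (N + N′) (N * (κ * M′) + (O + O′))
    word-∙ M N O M′ N′ O′ = begin
      ((a ∙ b) ∙ c) ∙ ((a′ ∙ b′) ∙ c′)
        ≈⟨ solve 6 (λ a b c a′ b′ c′ → ((a ⊕′ b) ⊕′ c) ⊕′ ((a′ ⊕′ b′) ⊕′ c′) ⊜ (a ⊕′ b) ⊕′ ((c ⊕′ (a′ ⊕′ b′)) ⊕′ c′)) refl a b c a′ b′ c′ ⟩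
      (a ∙ b) ∙ ((c ∙ (a′ ∙ b′)) ∙ c′)
        ≈⟨ ∙-cong refl (∙-cong z^O-central refl) ⟩
      (a ∙ b) ∙ (((a′ ∙ b′) ∙ c) ∙ c′)
        ≈⟨ solve 6 (λ a b a′ b′ c c′ → (a ⊕′ b) ⊕′ (((a′ ⊕′ b′) ⊕′ c) ⊕′ c′) ⊜ a ⊕′ ((b ⊕′ a′) ⊕′ (b′ ⊕′ (c ⊕′ c′)))) refl a b a′ b′ c c′ ⟩
      a ∙ ((b ∙ a′) ∙ (b′ ∙ (c ∙ c′)))
        ≈⟨ ∙-cong refl (∙-cong (y^∙x^ N M′) refl) ⟩
      a ∙ (((a′ ∙ b) ∙ d) ∙ (b′ ∙ (c ∙ c′)))
        ≈⟨ solve 7 (λ a a′ b d b′ c c′ → a ⊕′ (((a′ ⊕′ b) ⊕′ d) ⊕′ (b′ ⊕′ (c ⊕′ c′))) ⊜ (a ⊕′ a′) ⊕′ (b ⊕′ ((d ⊕′ b′) ⊕′ (c ⊕′ c′))))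
            refl a a′ b d b′ c c′ ⟩
      (a ∙ a′) ∙ (b ∙ ((d ∙ b′) ∙ (c ∙ c′)))
        ≈⟨ ∙-cong refl (∙-cong refl (∙-cong (commute-^ zy k N′) refl)) ⟩
      (a ∙ a′) ∙ (b ∙ ((b′ ∙ d) ∙ (c ∙ c′)))
        ≈⟨ solve 7 (λ a a′ b b′ d c c′ → (a ⊕′ a′) ⊕′ (b ⊕′ ((b′ ⊕′ d) ⊕′ (c ⊕′ c′))) ⊜ ((a ⊕′ a′) ⊕′ (b ⊕′ b′)) ⊕′ (d ⊕′ (c ⊕′ c′)))
            refl a a′ b b′ d c c′ ⟩
      ((a ∙ a′) ∙ (b ∙ b′)) ∙ (d ∙ (c ∙ c′))
        ≈⟨ ∙-cong (∙-cong (^-+ x M M′) (^-+ y N N′)) (∙-cong refl (^-+ z O O′)) ⟨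
      (x ^ (M + M′) ∙ y ^ (N + N′)) ∙ (d ∙ z ^ (O + O′))
        ≈⟨ ∙-cong refl (^-+ z k (O + O′)) ⟨
      word (M + M′) (N + N′) (k + (O + O′))   ∎
      where
      k : ℕ
      k = N * (κ * M′)
      a b c a′ b′ c′ d : Carrier
      a = x ^ M ; b = y ^ N ; c = z ^ O ; a′ = x ^ M′ ; b′ = y ^ N′ ; c′ = z ^ O′ ; d = z ^ k
      z^O-central : c ∙ (a′ ∙ b′) ≈ (a′ ∙ b′) ∙ c
      z^O-central = begin
        c ∙ (a′ ∙ b′)    ≈⟨ assoc c a′ b′ ⟨
        (c ∙ a′) ∙ b′    ≈⟨ ∙-cong (commute-^ zx O M′) refl ⟩
        (a′ ∙ c) ∙ b′    ≈⟨ assoc a′ c b′ ⟩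
        a′ ∙ (c ∙ b′)    ≈⟨ ∙-cong refl (commute-^ zy O N′) ⟩
        a′ ∙ (b′ ∙ c)    ≈⟨ assoc a′ b′ c ⟨
        (a′ ∙ b′) ∙ c    ∎

module ℚ/ℤ where

  open import Data.Nat as ℕ using (suc)
  import Data.Nat.Properties as ℕ
  open import Data.Integer as ℤ using (ℤ; +_)
  import Data.Integer.Properties as ℤ
  open import Data.Rational as ℚ using (ℚ; 0ℚ; 1ℚ; _+_; _*_; _-_; -_)
  import Data.Rational.Properties as ℚ
  open import Data.Rational.Unnormalised as ℚᵘ using (mkℚᵘ; *≡*) renaming (_≃_ to _≃ᵘ_)
  import Data.Rational.Unnormalised.Properties as ℚᵘ
  open import Data.Rational.Solver using (module +-*-Solver)
  open import Data.Integer.Tactic.RingSolver using (solve-∀)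
  open import Relation.Binary.Bundles using (Setoid)
  import Relation.Binary.Reasoning.Setoid as SetoidReasoning
  open import Relation.Binary.PropositionalEquality as ≡ using (_≡_; refl; cong; cong₂)

  ι : ℤ → ℚ
  ι z = z ℚ./ 1

  private
    toℚᵘ-ι : ∀ z → ℚ.toℚᵘ (ι z) ≃ᵘ mkℚᵘ z 0
    toℚᵘ-ι z = ℚ.toℚᵘ-fromℚᵘ (mkℚᵘ z 0)

    ι-≃ : ∀ {x y} → ℚ.toℚᵘ x ≃ᵘ mkℚᵘ y 0 → x ≡ ι y
    ι-≃ {x} {y} x≃y = ℚ.toℚᵘ-injective (ℚᵘ.≃-trans x≃y (ℚᵘ.≃-sym (toℚᵘ-ι y)))

  ι-homo-+ : ∀ a b → ι (a ℤ.+ b) ≡ ι a + ι b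
  ι-homo-+ a b = ≡.sym (ι-≃ (begin
    ℚ.toℚᵘ (ι a + ι b)                ≈⟨ ℚ.toℚᵘ-homo-+ (ι a) (ι b) ⟩
    ℚ.toℚᵘ (ι a) ℚᵘ.+ ℚ.toℚᵘ (ι b)    ≈⟨ ℚᵘ.+-cong (toℚᵘ-ι a) (toℚᵘ-ι b) ⟩
    mkℚᵘ (a ℤ.* + 1 ℤ.+ b ℤ.* + 1) 0  ≈⟨ *≡* (cong (ℤ._* + 1) (cong₂ ℤ._+_ (ℤ.*-identityʳ a) (ℤ.*-identityʳ b))) ⟩
    mkℚᵘ (a ℤ.+ b) 0                  ∎))
    where open ℚᵘ.≃-Reasoning

  ι-homo-* : ∀ a b → ι (a ℤ.* b) ≡ ι a * ι b
  ι-homo-* a b = ≡.sym (ι-≃ (begin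
    ℚ.toℚᵘ (ι a * ι b)                ≈⟨ ℚ.toℚᵘ-homo-* (ι a) (ι b) ⟩
    ℚ.toℚᵘ (ι a) ℚᵘ.* ℚ.toℚᵘ (ι b)    ≈⟨ ℚᵘ.*-cong (toℚᵘ-ι a) (toℚᵘ-ι b) ⟩
    mkℚᵘ (a ℤ.* b) 0                  ∎))
    where open ℚᵘ.≃-Reasoning

  ι-homo‿- : ∀ a → ι (ℤ.- a) ≡ - ι a
  ι-homo‿- a = ≡.sym (ι-≃ (ℚᵘ.≃-trans (ℚ.toℚᵘ-homo‿- (ι a)) (ℚᵘ.-‿cong (toℚᵘ-ι a))))

  ι-homo-− : ∀ a b → ι (a ℤ.- b) ≡ ι a - ι b
  ι-homo-− a b = ≡.trans (ι-homo-+ a (ℤ.- b)) (cong (λ r → ι a + r) (ι-homo‿- b))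

  ι-injective : ∀ {a b} → ι a ≡ ι b → a ≡ b
  ι-injective {a} {b} ιa≡ιb with ℚᵘ.≃-trans (ℚᵘ.≃-sym (toℚᵘ-ι a)) (ℚᵘ.≃-trans (ℚᵘ.≃-reflexive (cong ℚ.toℚᵘ ιa≡ιb)) (toℚᵘ-ι b))
  ... | *≡* a*1≡b*1 = ≡.trans (≡.sym (ℤ.*-identityʳ a)) (≡.trans a*1≡b*1 (ℤ.*-identityʳ b))

  n/d≡ιn*1/d : ∀ n d .{{_ : ℕ.NonZero d}} → + n ℚ./ d ≡ ι (+ n) * (+ 1 ℚ./ d)
  n/d≡ιn*1/d n (suc d) = ℚ.toℚᵘ-injective (begin
    ℚ.toℚᵘ (+ n ℚ./ suc d)                               ≈⟨ ℚ.toℚᵘ-fromℚᵘ (mkℚᵘ (+ n) d) ⟩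
    mkℚᵘ (+ n) d                                         ≈⟨ *≡* (cong₂ ℤ._*_ (ℤ.*-identityʳ (+ n)) (cong +_ (≡.sym (ℕ.*-identityˡ (suc d))))) ⟨
    mkℚᵘ (+ n) 0 ℚᵘ.* mkℚᵘ (+ 1) d                       ≈⟨ ℚᵘ.*-cong (toℚᵘ-ι (+ n)) (ℚ.toℚᵘ-fromℚᵘ (mkℚᵘ (+ 1) d)) ⟨
    ℚ.toℚᵘ (ι (+ n)) ℚᵘ.* ℚ.toℚᵘ (+ 1 ℚ./ suc d)         ≈⟨ ℚ.toℚᵘ-homo-* (ι (+ n)) (+ 1 ℚ./ suc d) ⟨
    ℚ.toℚᵘ (ι (+ n) * (+ 1 ℚ./ suc d))                   ∎)
    where open ℚᵘ.≃-Reasoning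

  ιd*1/d≡1 : ∀ d .{{_ : ℕ.NonZero d}} → ι (+ d) * (+ 1 ℚ./ d) ≡ 1ℚ
  ιd*1/d≡1 (suc d) = ℚ.toℚᵘ-injective (begin
    ℚ.toℚᵘ (ι (+ suc d) * (+ 1 ℚ./ suc d))              ≈⟨ ℚ.toℚᵘ-homo-* (ι (+ suc d)) (+ 1 ℚ./ suc d) ⟩
    ℚ.toℚᵘ (ι (+ suc d)) ℚᵘ.* ℚ.toℚᵘ (+ 1 ℚ./ suc d)    ≈⟨ ℚᵘ.*-cong (toℚᵘ-ι (+ suc d)) (ℚ.toℚᵘ-fromℚᵘ (mkℚᵘ (+ 1) d)) ⟩
    mkℚᵘ (+ suc d) 0 ℚᵘ.* mkℚᵘ (+ 1) d                  ≈⟨ *≡* (cancel (+ suc d)) ⟩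
    mkℚᵘ (+ 1) 0                                        ∎)
    where
    open ℚᵘ.≃-Reasoning
    cancel : ∀ D → (D ℤ.* + 1) ℤ.* + 1 ≡ + 1 ℤ.* (+ 1 ℤ.* D)
    cancel = solve-∀

  -- Equality in ℚ/ℤ; a record rather than a Σ-type so that x and y can be inferred from a proof.
  infix 4 _≈_
  infixr 4 _,_
  record _≈_ (x y : ℚ) : Set where
    constructor _,_
    field
      integer : ℤ
      x-y≡integer : x - y ≡ ι integer

  open +-*-Solver

  ≈-refl : ∀ {x} → x ≈ x
  ≈-refl {x} = + 0 , ℚ.+-inverseʳ x

  ≡⇒≈ : ∀ {x y} → x ≡ y → x ≈ y
  ≡⇒≈ refl = ≈-refl

  ≈-sym : ∀ {x y} → x ≈ y → y ≈ x
  ≈-sym {x} {y} (z , x-y≡z) = ℤ.- z , (begin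
    y - x       ≡⟨ solve 2 (λ x y → y :- x := :- (x :- y)) refl x y ⟩
    - (x - y)   ≡⟨ cong -_ x-y≡z ⟩
    - ι z       ≡⟨ ι-homo‿- z ⟨
    ι (ℤ.- z)   ∎)
    where open ≡.≡-Reasoning

  ≈-trans : ∀ {x y w} → x ≈ y → y ≈ w → x ≈ w
  ≈-trans {x} {y} {w} (z₁ , x-y≡z₁) (z₂ , y-w≡z₂) = z₁ ℤ.+ z₂ , (begin
    x - w                ≡⟨ solve 3 (λ x y w → x :- w := (x :- y) :+ (y :- w)) refl x y w ⟩
    (x - y) + (y - w)    ≡⟨ cong₂ _+_ x-y≡z₁ y-w≡z₂ ⟩
    ι z₁ + ι z₂          ≡⟨ ι-homo-+ z₁ z₂ ⟨
    ι (z₁ ℤ.+ z₂)        ∎)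
    where open ≡.≡-Reasoning

  setoid : Setoid _ _
  setoid = record
    { Carrier = ℚ ; _≈_ = _≈_
    ; isEquivalence = record { refl = ≈-refl ; sym = ≈-sym ; trans = ≈-trans } }

  module ≈-Reasoning = SetoidReasoning setoid

  +-cong : ∀ {x x′ y y′} → x ≈ x′ → y ≈ y′ → x + y ≈ x′ + y′
  +-cong {x} {x′} {y} {y′} (z₁ , x-x′≡z₁) (z₂ , y-y′≡z₂) = z₁ ℤ.+ z₂ , (begin
    (x + y) - (x′ + y′)      ≡⟨ solve 4 (λ x x′ y y′ → (x :+ y) :- (x′ :+ y′) := (x :- x′) :+ (y :- y′)) refl x x′ y y′ ⟩
    (x - x′) + (y - y′)      ≡⟨ cong₂ _+_ x-x′≡z₁ y-y′≡z₂ ⟩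
    ι z₁ + ι z₂              ≡⟨ ι-homo-+ z₁ z₂ ⟨
    ι (z₁ ℤ.+ z₂)            ∎)
    where open ≡.≡-Reasoning

  -‿cong : ∀ {x y} → x ≈ y → - x ≈ - y
  -‿cong {x} {y} (z , x-y≡z) = ℤ.- z , (begin
    - x - - y      ≡⟨ solve 2 (λ x y → (:- x) :- (:- y) := :- (x :- y)) refl x y ⟩
    - (x - y)      ≡⟨ cong -_ x-y≡z ⟩
    - ι z          ≡⟨ ι-homo‿- z ⟨
    ι (ℤ.- z)      ∎)
    where open ≡.≡-Reasoning

  -‿+-cong : ∀ {x x′ y y′} → x ≈ x′ → y ≈ y′ → x - y ≈ x′ - y′
  -‿+-cong x≈x′ y≈y′ = +-cong x≈x′ (-‿cong y≈y′)

  ι*-cong : ∀ k {x y} → x ≈ y → ι k * x ≈ ι k * y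
  ι*-cong k {x} {y} (z , x-y≡z) = k ℤ.* z , (begin
    ι k * x - ι k * y    ≡⟨ solve 3 (λ k x y → k :* x :- k :* y := k :* (x :- y)) refl (ι k) x y ⟩
    ι k * (x - y)        ≡⟨ cong (ι k *_) x-y≡z ⟩
    ι k * ι z            ≡⟨ ι-homo-* k z ⟨
    ι (k ℤ.* z)          ∎)
    where open ≡.≡-Reasoning

  ι≈0 : ∀ z → ι z ≈ 0ℚ
  ι≈0 z = z , ℚ.+-identityʳ (ι z)

  +-ι : ∀ x z → x + ι z ≈ x
  +-ι x z = z , solve 2 (λ x z → (x :+ z) :- x := z) refl x (ι z)

  x≈y⇒x-y≈0 : ∀ {x y} → x ≈ y → x - y ≈ 0ℚ
  x≈y⇒x-y≈0 {x} {y} (z , x-y≡z) = z , ≡.trans (ℚ.+-identityʳ (x - y)) x-y≡z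

  x-y≈0⇒x≈y : ∀ {x y} → x - y ≈ 0ℚ → x ≈ y
  x-y≈0⇒x≈y {x} {y} (z , eq) = z , ≡.trans (≡.sym (ℚ.+-identityʳ (x - y))) eq

  +-cancelˡ : ∀ x {y w} → x + y ≈ x + w → y ≈ w
  +-cancelˡ x {y} {w} (z , eq) = z , ≡.trans (solve 3 (λ x y w → y :- w := (x :+ y) :- (x :+ w)) refl x y w) eq

module Model (p : ℕ) .{{_ : NonZero p}} (p∣choose₂p : p ∣ℕ choose₂ p) where

  open import Data.Fin using (toℕ)
  open import Data.Fin.Properties using (toℕ-injective; toℕ<n)
  open import Data.List.Membership.Propositional using (_∈_)
  open import Data.Nat using (zero; suc; _+_; _*_; _∸_; _%_)
  open import Data.Nat.Properties using (+-assoc; +-identityʳ; *-zeroʳ; *-identityʳ; m+[n∸m]≡n; <⇒≤; suc-pred; +-comm; *-distribˡ-+)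
  open import Data.Nat.Tactic.RingSolver using (solve-∀)
  open import Data.Product using (_×_; _,_; proj₁; proj₂)
  open import Relation.Binary.PropositionalEquality using (_≡_; refl; sym; trans; cong; cong₂; subst; module ≡-Reasoning)

  open ModularArithmetic p

  infixl 7 _∙_
  _∙_ : G p → G p → G p
  _∙_ = _·_ p

  infixr 8 _^ᴳ_
  _^ᴳ_ : G p → ℕ → G p
  _^ᴳ_ = Defs._^ᴳ_ p

  1ᴳ a b c : G p
  1ᴳ = e p
  a = gen-a p
  b = gen-b p
  c = gen-c p

  s[_] t[_] u[_] : G p → ℕ
  s[ x ] = toℕ (proj₁ x)
  t[ x ] = toℕ (proj₁ (proj₂ x))
  u[ x ] = toℕ (proj₂ (proj₂ x))

  -- x ~ (s , t , u) says that x = a^s b^t c^u, the exponents being read modulo p.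
  infix 4 _~_
  _~_ : G p → ℕ × ℕ × ℕ → Set
  x ~ (s , t , u) = s[ x ] ≡ₚ s × t[ x ] ≡ₚ t × u[ x ] ≡ₚ u

  ~-refl : ∀ x → x ~ (s[ x ] , t[ x ] , u[ x ])
  ~-refl x = refl , refl , refl

  ~-unique : ∀ {x y T} → x ~ T → y ~ T → x ≡ y
  ~-unique {s₁ , t₁ , u₁} {s₂ , t₂ , u₂} (s₁≡ , t₁≡ , u₁≡) (s₂≡ , t₂≡ , u₂≡) =
    cong₂ _,_ (coordinate s₁ s₂ s₁≡ s₂≡) (cong₂ _,_ (coordinate t₁ t₂ t₁≡ t₂≡) (coordinate u₁ u₂ u₁≡ u₂≡))
    where
    coordinate : ∀ {r} i j → toℕ i ≡ₚ r → toℕ j ≡ₚ r → i ≡ j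
    coordinate i j i≡r j≡r = toℕ-injective (≡ₚ⇒≡ (toℕ<n i) (toℕ<n j) (trans i≡r (sym j≡r)))

  ~-resp : ∀ {x s t u s′ t′ u′} → x ~ (s , t , u) → s ≡ₚ s′ → t ≡ₚ t′ → u ≡ₚ u′ → x ~ (s′ , t′ , u′)
  ~-resp (s≡ , t≡ , u≡) s≡s′ t≡t′ u≡u′ = trans s≡ s≡s′ , trans t≡ t≡t′ , trans u≡ u≡u′

  ~-∙ : ∀ {x y s₁ t₁ u₁ s₂ t₂ u₂} → x ~ (s₁ , t₁ , u₁) → y ~ (s₂ , t₂ , u₂) →
        x ∙ y ~ (s₁ + s₂ , t₁ + t₂ , u₁ + u₂ + t₁ * s₂)
  ~-∙ {x} {y} (s₁≡ , t₁≡ , u₁≡) (s₂≡ , t₂≡ , u₂≡) =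
    trans (toℕ-mod≡ₚ _) (+-congₚ s₁≡ s₂≡) ,
    trans (toℕ-mod≡ₚ _) (+-congₚ t₁≡ t₂≡) ,
    trans (toℕ-mod≡ₚ _) (+-congₚ (+-congₚ u₁≡ u₂≡) (*-congₚ t₁≡ s₂≡))

  ~-1 : 1ᴳ ~ (0 , 0 , 0)
  ~-1 = toℕ-mod≡ₚ 0 , toℕ-mod≡ₚ 0 , toℕ-mod≡ₚ 0

  ~-a : a ~ (1 , 0 , 0)
  ~-a = toℕ-mod≡ₚ 1 , toℕ-mod≡ₚ 0 , toℕ-mod≡ₚ 0

  ~-b : b ~ (0 , 1 , 0)
  ~-b = toℕ-mod≡ₚ 0 , toℕ-mod≡ₚ 1 , toℕ-mod≡ₚ 0

  ~-c : c ~ (0 , 0 , 1)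
  ~-c = toℕ-mod≡ₚ 0 , toℕ-mod≡ₚ 0 , toℕ-mod≡ₚ 1

  ~-inv : ∀ x → inv p x ~ (p ∸ s[ x ] , p ∸ t[ x ] , (p ∸ u[ x ]) + t[ x ] * s[ x ])
  ~-inv x = toℕ-mod≡ₚ _ , toℕ-mod≡ₚ _ , toℕ-mod≡ₚ _

  ~-^ : ∀ {x s t u} → x ~ (s , t , u) → ∀ k → x ^ᴳ k ~ (k * s , k * t , k * u + t * s * choose₂ k)
  ~-^ {x} {s} {t} {u} x~ zero    = ~-resp ~-1 refl refl (≡⇒≡ₚ (sym (*-zeroʳ (t * s))))
  ~-^ {x} {s} {t} {u} x~ (suc k) = ~-resp (~-∙ x~ (~-^ x~ k)) refl refl (≡⇒≡ₚ (exponent s t u k (choose₂ k)))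
    where
    exponent : ∀ s t u k c → u + (k * u + t * s * c) + t * (k * s) ≡ u + k * u + t * s * (c + k)
    exponent = solve-∀

  ∙-assoc : ∀ x y z → (x ∙ y) ∙ z ≡ x ∙ (y ∙ z)
  ∙-assoc x y z = ~-unique (~-∙ (~-∙ (~-refl x) (~-refl y)) (~-refl z))
    (~-resp (~-∙ (~-refl x) (~-∙ (~-refl y) (~-refl z)))
      (≡⇒≡ₚ (sym (+-assoc s[ x ] s[ y ] s[ z ])))
      (≡⇒≡ₚ (sym (+-assoc t[ x ] t[ y ] t[ z ])))
      (≡⇒≡ₚ (exponent u[ x ] u[ y ] u[ z ] t[ x ] t[ y ] s[ y ] s[ z ])))
    where
    exponent : ∀ u₁ u₂ u₃ t₁ t₂ s₂ s₃ →
               u₁ + (u₂ + u₃ + t₂ * s₃) + t₁ * (s₂ + s₃) ≡ u₁ + u₂ + t₁ * s₂ + u₃ + (t₁ + t₂) * s₃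
    exponent = solve-∀

  ∙-identityˡ : ∀ x → 1ᴳ ∙ x ≡ x
  ∙-identityˡ x = ~-unique (~-∙ ~-1 (~-refl x)) (~-resp (~-refl x) refl refl (≡⇒≡ₚ (sym (+-identityʳ u[ x ]))))

  ∙-identityʳ : ∀ x → x ∙ 1ᴳ ≡ x
  ∙-identityʳ x = ~-unique (~-∙ (~-refl x) ~-1)
    (~-resp (~-refl x) (≡⇒≡ₚ (sym (+-identityʳ s[ x ]))) (≡⇒≡ₚ (sym (+-identityʳ t[ x ])))
      (≡⇒≡ₚ (exponent u[ x ] t[ x ])))
    where
    exponent : ∀ u t → u ≡ u + 0 + t * 0
    exponent = solve-∀

  ∙-inverseʳ : ∀ x → x ∙ inv p x ≡ 1ᴳ
  ∙-inverseʳ x = ~-unique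
    (~-resp (~-∙ (~-refl x) (~-inv x))
      (trans (≡⇒≡ₚ (m+[n∸m]≡n (<⇒≤ (toℕ<n (proj₁ x))))) p≡ₚ0)
      (trans (≡⇒≡ₚ (m+[n∸m]≡n (<⇒≤ (toℕ<n (proj₁ (proj₂ x)))))) p≡ₚ0)
      (trans (≡⇒≡ₚ exponent) (*p≡ₚ0 (suc t))))
    ~-1
    where
    s t u : ℕ
    s = s[ x ] ; t = t[ x ] ; u = u[ x ]
    exponent : u + ((p ∸ u) + t * s) + t * (p ∸ s) ≡ suc t * p
    exponent = begin
      u + ((p ∸ u) + t * s) + t * (p ∸ s)   ≡⟨ regroup u (p ∸ u) (t * s) (t * (p ∸ s)) ⟩
      (u + (p ∸ u)) + (t * s + t * (p ∸ s)) ≡⟨ cong₂ _+_ (m+[n∸m]≡n (<⇒≤ (toℕ<n (proj₂ (proj₂ x))))) (sym (*-distribˡ-+ t s (p ∸ s))) ⟩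
      p + t * (s + (p ∸ s))                 ≡⟨ cong (λ r → p + t * r) (m+[n∸m]≡n (<⇒≤ (toℕ<n (proj₁ x)))) ⟩
      p + t * p                             ∎
      where
      open ≡-Reasoning
      regroup : ∀ a b c d → a + (b + c) + d ≡ (a + b) + (c + d)
      regroup = solve-∀

  ^ᴳ-+ : ∀ x m n → x ^ᴳ (m + n) ≡ x ^ᴳ m ∙ x ^ᴳ n
  ^ᴳ-+ x zero    n = sym (∙-identityˡ (x ^ᴳ n))
  ^ᴳ-+ x (suc m) n = trans (cong (x ∙_) (^ᴳ-+ x m n)) (sym (∙-assoc x (x ^ᴳ m) (x ^ᴳ n)))

  ^ᴳ-p : ∀ x → x ^ᴳ p ≡ 1ᴳ
  ^ᴳ-p x = ~-unique
    (~-resp (~-^ (~-refl x) p) (p*≡ₚ0 s[ x ]) (p*≡ₚ0 t[ x ])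
      (trans (+-congₚ (p*≡ₚ0 u[ x ]) (*-congₚ (≡ₚ-refl (t[ x ] * s[ x ])) (choose₂-congₚ p∣choose₂p p≡ₚ0)))
             (≡⇒≡ₚ (exponent (t[ x ] * s[ x ])))))
    ~-1
    where
    exponent : ∀ a → 0 + a * 0 ≡ 0
    exponent = solve-∀

  inv≡^ᴳ[p∸1] : ∀ x → inv p x ≡ x ^ᴳ (p ∸ 1)
  inv≡^ᴳ[p∸1] x = begin
    inv p x                           ≡⟨ ∙-identityˡ (inv p x) ⟨
    1ᴳ ∙ inv p x                      ≡⟨ cong (_∙ inv p x) x^ᴳ[p∸1]∙x≡1 ⟨
    (x ^ᴳ (p ∸ 1) ∙ x) ∙ inv p x       ≡⟨ ∙-assoc (x ^ᴳ (p ∸ 1)) x (inv p x) ⟩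
    x ^ᴳ (p ∸ 1) ∙ (x ∙ inv p x)       ≡⟨ cong (x ^ᴳ (p ∸ 1) ∙_) (∙-inverseʳ x) ⟩
    x ^ᴳ (p ∸ 1) ∙ 1ᴳ                  ≡⟨ ∙-identityʳ (x ^ᴳ (p ∸ 1)) ⟩
    x ^ᴳ (p ∸ 1)                       ∎
    where
    open ≡-Reasoning
    x^ᴳ[p∸1]∙x≡1 : x ^ᴳ (p ∸ 1) ∙ x ≡ 1ᴳ
    x^ᴳ[p∸1]∙x≡1 = begin
      x ^ᴳ (p ∸ 1) ∙ x            ≡⟨ cong (x ^ᴳ (p ∸ 1) ∙_) (∙-identityʳ x) ⟨
      x ^ᴳ (p ∸ 1) ∙ x ^ᴳ 1        ≡⟨ ^ᴳ-+ x (p ∸ 1) 1 ⟨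
      x ^ᴳ (p ∸ 1 + 1)            ≡⟨ cong (x ^ᴳ_) (trans (+-comm (p ∸ 1) 1) (suc-pred p)) ⟩
      x ^ᴳ p                      ≡⟨ ^ᴳ-p x ⟩
      1ᴳ                         ∎

  c-central : ∀ x → c ∙ x ≡ x ∙ c
  c-central x = ~-unique (~-∙ ~-c (~-refl x))
    (~-resp (~-∙ (~-refl x) ~-c) (≡⇒≡ₚ (+-comm s[ x ] 0)) (≡⇒≡ₚ (+-comm t[ x ] 0)) (≡⇒≡ₚ (exponent u[ x ] t[ x ] s[ x ])))
    where
    exponent : ∀ u t s → u + 1 + t * 0 ≡ 1 + u + 0 * s
    exponent = solve-∀

  b∙a≡a∙b∙c : b ∙ a ≡ a ∙ b ∙ c
  b∙a≡a∙b∙c = ~-unique (~-∙ ~-b ~-a) (~-∙ (~-∙ ~-a ~-b) ~-c)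

  module _ (P : G p → Set) (P-1 : P 1ᴳ) (P-∙ : ∀ {x y} → P x → P y → P (x ∙ y)) where

    P-^ᴳ : ∀ {x} → P x → ∀ n → P (x ^ᴳ n)
    P-^ᴳ Px zero    = P-1
    P-^ᴳ Px (suc n) = P-∙ Px (P-^ᴳ Px n)

    -- A submonoid of a group of exponent p is a subgroup.
    ⟪⟫-ind : ∀ {S} → (∀ {x} → x ∈ S → P x) → ∀ {x} → ⟪_⟫ p S x → P x
    ⟪⟫-ind P-S (base x∈S)      = P-S x∈S
    ⟪⟫-ind P-S one             = P-1
    ⟪⟫-ind P-S (mul Sx Sy)     = P-∙ (⟪⟫-ind P-S Sx) (⟪⟫-ind P-S Sy)
    ⟪⟫-ind P-S (inv′ {x} Sx)   = subst P (sym (inv≡^ᴳ[p∸1] x)) (P-^ᴳ (⟪⟫-ind P-S Sx) (p ∸ 1))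

  ~-c^ : ∀ N → c ^ᴳ N ~ (0 , 0 , N)
  ~-c^ N = ~-resp (~-^ ~-c N) (≡⇒≡ₚ (*-zeroʳ N)) (≡⇒≡ₚ (*-zeroʳ N)) (≡⇒≡ₚ (exponent N (choose₂ N)))
    where
    exponent : ∀ N C → N * 1 + 0 * 0 * C ≡ N
    exponent = solve-∀

  ~-b^ : ∀ M → b ^ᴳ M ~ (0 , M , 0)
  ~-b^ M = ~-resp (~-^ ~-b M) (≡⇒≡ₚ (*-zeroʳ M)) (≡⇒≡ₚ (*-identityʳ M)) (≡⇒≡ₚ (exponent M (choose₂ M)))
    where
    exponent : ∀ M C → M * 0 + 1 * 0 * C ≡ 0
    exponent = solve-∀

  ~-ab^ : ∀ i → a ∙ b ^ᴳ i ~ (1 , i , 0)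
  ~-ab^ i = ~-resp (~-∙ ~-a (~-b^ i)) refl refl (≡⇒≡ₚ (*-zeroʳ 0))

  ~-[ab^]^ : ∀ i M → (a ∙ b ^ᴳ i) ^ᴳ M ~ (M , M * i , i * choose₂ M)
  ~-[ab^]^ i M = ~-resp (~-^ (~-ab^ i) M) (≡⇒≡ₚ (*-identityʳ M)) refl (≡⇒≡ₚ (exponent M i (choose₂ M)))
    where
    exponent : ∀ M i C → M * 0 + i * 1 * C ≡ i * C
    exponent = solve-∀

  ~-[ab^]^∙c^ : ∀ i M N → (a ∙ b ^ᴳ i) ^ᴳ M ∙ c ^ᴳ N ~ (M , M * i , i * choose₂ M + N)
  ~-[ab^]^∙c^ i M N = ~-resp (~-∙ (~-[ab^]^ i M) (~-c^ N)) (≡⇒≡ₚ (+-identityʳ M)) (≡⇒≡ₚ (+-identityʳ (M * i)))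
    (≡⇒≡ₚ (exponent (i * choose₂ M) N (M * i)))
    where
    exponent : ∀ A N T → A + N + T * 0 ≡ A + N
    exponent = solve-∀

  ~-b^∙c^ : ∀ M N → b ^ᴳ M ∙ c ^ᴳ N ~ (0 , M , N)
  ~-b^∙c^ M N = ~-resp (~-∙ (~-b^ M) (~-c^ N)) refl (≡⇒≡ₚ (+-identityʳ M)) (≡⇒≡ₚ (exponent M N))
    where
    exponent : ∀ M N → 0 + N + M * 0 ≡ N
    exponent = solve-∀

module Cochains (p : ℕ) .{{_ : NonZero p}} (p∣choose₂p : p ∣ℕ choose₂ p) where

  open import Data.Nat as ℕ using (zero; suc; _%_)
  open import Data.Nat.DivMod using (m≡m%n+[m/n]*n)
  import Data.Nat.Tactic.RingSolver as ℕ-Solver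
  open import Data.Integer as ℤ using (ℤ; +_)
  import Data.Integer.Properties as ℤ
  open import Data.Integer.Divisibility.Signed using (_∣_; divides)
  open import Data.Rational as ℚ using (ℚ; 0ℚ; 1ℚ; _+_; _*_; _-_; -_)
  import Data.Rational.Properties as ℚ
  open import Data.Rational.Solver using (module +-*-Solver)
  open import Data.Product using (Σ-syntax; _,_)
  open import Data.Unit using (⊤; tt)
  open import Relation.Binary.PropositionalEquality as ≡ using (_≡_; refl; cong; cong₂)

  open ModularArithmetic p
  open Model p p∣choose₂p
  open ℚ/ℤ
  open +-*-Solver

  infixl 6 _⊕_
  _⊕_ : C² p → C² p → C² p
  _⊕_ = Defs._⊕_ p

  infixl 7 _⊙_
  _⊙_ : ℤ → C² p → C² p
  _⊙_ = Defs._⊙_ p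

  infix 8 _/p
  _/p : ℕ → ℚ
  n /p = + n ℚ./ p

  1/p : ℚ
  1/p = 1 /p

  /p≡ι*1/p : ∀ n → n /p ≡ ι (+ n) * 1/p
  /p≡ι*1/p n = n/d≡ιn*1/d n p

  /p-homo-+ : ∀ m n → (m ℕ.+ n) /p ≡ m /p + n /p
  /p-homo-+ m n = begin
    (m ℕ.+ n) /p                      ≡⟨ /p≡ι*1/p (m ℕ.+ n) ⟩
    ι (+ m ℤ.+ + n) * 1/p             ≡⟨ cong (_* 1/p) (ι-homo-+ (+ m) (+ n)) ⟩
    (ι (+ m) + ι (+ n)) * 1/p         ≡⟨ ℚ.*-distribʳ-+ 1/p (ι (+ m)) (ι (+ n)) ⟩
    ι (+ m) * 1/p + ι (+ n) * 1/p     ≡⟨ cong₂ _+_ (/p≡ι*1/p m) (/p≡ι*1/p n) ⟨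
    m /p + n /p                       ∎
    where open ≡.≡-Reasoning

  /p-+*p : ∀ m k → (m ℕ.+ k ℕ.* p) /p ≡ m /p + ι (+ k)
  /p-+*p m k = begin
    (m ℕ.+ k ℕ.* p) /p                        ≡⟨ /p-homo-+ m (k ℕ.* p) ⟩
    m /p + (k ℕ.* p) /p                       ≡⟨ cong (m /p +_) (/p≡ι*1/p (k ℕ.* p)) ⟩
    m /p + ι (+ (k ℕ.* p)) * 1/p              ≡⟨ cong (λ r → m /p + ι r * 1/p) (ℤ.pos-* k p) ⟩
    m /p + ι (+ k ℤ.* + p) * 1/p              ≡⟨ cong (λ r → m /p + r * 1/p) (ι-homo-* (+ k) (+ p)) ⟩
    m /p + ι (+ k) * ι (+ p) * 1/p            ≡⟨ cong (m /p +_) (ℚ.*-assoc (ι (+ k)) (ι (+ p)) 1/p) ⟩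
    m /p + ι (+ k) * (ι (+ p) * 1/p)          ≡⟨ cong (λ r → m /p + ι (+ k) * r) (ιd*1/d≡1 p) ⟩
    m /p + ι (+ k) * 1ℚ                       ≡⟨ cong (m /p +_) (ℚ.*-identityʳ (ι (+ k))) ⟩
    m /p + ι (+ k)                            ∎
    where open ≡.≡-Reasoning

  /p-congₚ : ∀ {m n} → m ≡ₚ n → m /p ≈ n /p
  /p-congₚ {m} {n} m≡n = begin
    m /p                                  ≡⟨ cong _/p (m≡m%n+[m/n]*n m p) ⟩
    (m % p ℕ.+ m ℕ./ p ℕ.* p) /p          ≡⟨ /p-+*p (m % p) (m ℕ./ p) ⟩
    (m % p) /p + ι (+ (m ℕ./ p))          ≈⟨ +-ι ((m % p) /p) (+ (m ℕ./ p)) ⟩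
    (m % p) /p                            ≡⟨ cong _/p m≡n ⟩
    (n % p) /p                            ≈⟨ +-ι ((n % p) /p) (+ (n ℕ./ p)) ⟨
    (n % p) /p + ι (+ (n ℕ./ p))          ≡⟨ /p-+*p (n % p) (n ℕ./ p) ⟨
    (n % p ℕ.+ n ℕ./ p ℕ.* p) /p          ≡⟨ cong _/p (m≡m%n+[m/n]*n n p) ⟨
    n /p                                  ∎
    where open ≈-Reasoning

  ι*1/p≈0⇒∣ : ∀ z → ι z * 1/p ≈ 0ℚ → + p ∣ z
  ι*1/p≈0⇒∣ z (q , z/p-0≡q) = divides q (ι-injective (begin
    ι z                          ≡⟨ ℚ.*-identityʳ (ι z) ⟨
    ι z * 1ℚ                     ≡⟨ cong (ι z *_) (ιd*1/d≡1 p) ⟨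
    ι z * (ι (+ p) * 1/p)        ≡⟨ solve 3 (λ z P I → z :* (P :* I) := (z :* I :- con 0ℚ) :* P) refl (ι z) (ι (+ p)) 1/p ⟩
    (ι z * 1/p - 0ℚ) * ι (+ p)   ≡⟨ cong (_* ι (+ p)) z/p-0≡q ⟩
    ι q * ι (+ p)                ≡⟨ ι-homo-* q (+ p) ⟨
    ι (q ℤ.* + p)                ∎))
    where open ≡.≡-Reasoning

  ∣⇒ι*/p≈0 : ∀ {z} → + p ∣ z → ∀ n → ι z * n /p ≈ 0ℚ
  ∣⇒ι*/p≈0 {z} (divides q refl) n = ≈-trans (≡⇒≈ (begin
    ι (q ℤ.* + p) * n /p                 ≡⟨ cong₂ _*_ (ι-homo-* q (+ p)) (/p≡ι*1/p n) ⟩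
    ι q * ι (+ p) * (ι (+ n) * 1/p)      ≡⟨ solve 4 (λ q P n I → q :* P :* (n :* I) := q :* n :* (P :* I)) refl (ι q) (ι (+ p)) (ι (+ n)) 1/p ⟩
    ι q * ι (+ n) * (ι (+ p) * 1/p)      ≡⟨ cong (ι q * ι (+ n) *_) (ιd*1/d≡1 p) ⟩
    ι q * ι (+ n) * 1ℚ                   ≡⟨ ℚ.*-identityʳ (ι q * ι (+ n)) ⟩
    ι q * ι (+ n)                        ≡⟨ ι-homo-* q (+ n) ⟨
    ι (q ℤ.* + n)                        ∎)) (ι≈0 (q ℤ.* + n))
    where open ≡.≡-Reasoning

  ι*1/p-homo-+ : ∀ m n → ι m * 1/p + ι n * 1/p ≡ ι (m ℤ.+ n) * 1/p
  ι*1/p-homo-+ m n = ≡.trans (≡.sym (ℚ.*-distribʳ-+ 1/p (ι m) (ι n))) (cong (_* 1/p) (≡.sym (ι-homo-+ m n)))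

  -- IsCocycle, IsCoboundary and CoboundaryOn with ℚ/ℤ-equality taken as the record _≈_.
  Cocycle : C² p → Set
  Cocycle f = ∀ g h k → f h k + f g (h ∙ k) ≈ f (g ∙ h) k + f g h

  CoboundaryOn′ : (G p → Set) → C² p → Set
  CoboundaryOn′ H f = Σ[ φ ∈ (G p → ℚ) ] ∀ {x y} → H x → H y → f x y ≈ φ x + φ y - φ (x ∙ y)

  Coboundary : C² p → Set
  Coboundary f = Σ[ φ ∈ (G p → ℚ) ] ∀ x y → f x y ≈ φ x + φ y - φ (x ∙ y)

  CoboundaryOn′-mono : ∀ {H H′ f} → (∀ {x} → H x → H′ x) → CoboundaryOn′ H′ f → CoboundaryOn′ H f
  CoboundaryOn′-mono H⊆H′ (φ , f≈δφ) = φ , λ Hx Hy → f≈δφ (H⊆H′ Hx) (H⊆H′ Hy)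

  Coboundary-resp : ∀ {F F′} → (∀ x y → F x y ≈ F′ x y) → Coboundary F → Coboundary F′
  Coboundary-resp F≈F′ (φ , F≈δφ) = φ , λ x y → ≈-trans (≈-sym (F≈F′ x y)) (F≈δφ x y)

  ≈0⇒Coboundary : ∀ {F} → (∀ x y → F x y ≈ 0ℚ) → Coboundary F
  ≈0⇒Coboundary F≈0 = (λ _ → 0ℚ) , λ x y → ≈-trans (F≈0 x y) (≡⇒≈ refl)

  Coboundary-⊕ : ∀ {F F′} → Coboundary F → Coboundary F′ → Coboundary (F ⊕ F′)
  Coboundary-⊕ (φ , F≈δφ) (ψ , F′≈δψ) = (λ x → φ x + ψ x) , λ x y → ≈-trans (+-cong (F≈δφ x y) (F′≈δψ x y))
    (≡⇒≈ (solve 6 (λ a b d a′ b′ d′ → (a :+ b :- d) :+ (a′ :+ b′ :- d′) := (a :+ a′) :+ (b :+ b′) :- (d :+ d′)) refl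
                   (φ x) (φ y) (φ (x ∙ y)) (ψ x) (ψ y) (ψ (x ∙ y))))

  Coboundary⇒CoboundaryOn′ : ∀ {H F} → Coboundary F → CoboundaryOn′ H F
  Coboundary⇒CoboundaryOn′ (φ , F≈δφ) = φ , λ {x} {y} _ _ → F≈δφ x y

  f₁-≈ : ∀ {x y s₁ t₁ u₁ s₂ t₂ u₂} → x ~ (s₁ , t₁ , u₁) → y ~ (s₂ , t₂ , u₂) →
         f₁ p x y ≈ (u₁ ℕ.* s₂ ℕ.+ t₁ ℕ.* choose₂ s₂) /p
  f₁-≈ {x} {y} (_ , t₁≡ , u₁≡) (s₂≡ , _ , _) =
    /p-congₚ (+-congₚ (*-congₚ u₁≡ s₂≡) (*-congₚ t₁≡ (≡.trans (≡⇒≡ₚ (n[n∸1]/2≡choose₂ s[ y ])) (choose₂-congₚ p∣choose₂p s₂≡))))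

  f₂-≈ : ∀ {x y s₁ t₁ u₁ s₂ t₂ u₂} → x ~ (s₁ , t₁ , u₁) → y ~ (s₂ , t₂ , u₂) →
         f₂ p x y ≈ (choose₂ t₁ ℕ.* s₂ ℕ.+ (t₁ ℕ.* s₂ ℕ.+ u₁) ℕ.* t₂) /p
  f₂-≈ {x} {y} (_ , t₁≡ , u₁≡) (s₂≡ , t₂≡ , _) =
    /p-congₚ (+-congₚ (*-congₚ (≡.trans (≡⇒≡ₚ (n[n∸1]/2≡choose₂ t[ x ])) (choose₂-congₚ p∣choose₂p t₁≡)) s₂≡)
                      (*-congₚ (+-congₚ (*-congₚ t₁≡ s₂≡) u₁≡) t₂≡))

  /p+/p-cong : ∀ A B C D → A ℕ.+ B ≡ C ℕ.+ D → A /p + B /p ≡ C /p + D /p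
  /p+/p-cong A B C D eq = ≡.trans (≡.sym (/p-homo-+ A B)) (≡.trans (cong _/p eq) (/p-homo-+ C D))

  f₁-cocycle : Cocycle (f₁ p)
  f₁-cocycle g h k = begin
    f₁ p h k + f₁ p g (h ∙ k)
      ≈⟨ +-cong (f₁-≈ (~-refl h) (~-refl k)) (f₁-≈ (~-refl g) (~-∙ (~-refl h) (~-refl k))) ⟩
    A /p + B /p
      ≡⟨ /p+/p-cong A B C D (≡.trans (cong (λ r → A ℕ.+ (u₁ ℕ.* (s₂ ℕ.+ s₃) ℕ.+ t₁ ℕ.* r)) (choose₂-+ s₂ s₃))
                                     (identity s₂ s₃ t₁ t₂ u₁ u₂ (choose₂ s₂) (choose₂ s₃))) ⟩
    C /p + D /p
      ≈⟨ +-cong (f₁-≈ (~-∙ (~-refl g) (~-refl h)) (~-refl k)) (f₁-≈ (~-refl g) (~-refl h)) ⟨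
    f₁ p (g ∙ h) k + f₁ p g h ∎
    where
    open ≈-Reasoning
    s₂ s₃ t₁ t₂ u₁ u₂ A B C D : ℕ
    s₂ = s[ h ] ; s₃ = s[ k ] ; t₁ = t[ g ] ; t₂ = t[ h ] ; u₁ = u[ g ] ; u₂ = u[ h ]
    A = u₂ ℕ.* s₃ ℕ.+ t₂ ℕ.* choose₂ s₃
    B = u₁ ℕ.* (s₂ ℕ.+ s₃) ℕ.+ t₁ ℕ.* choose₂ (s₂ ℕ.+ s₃)
    C = (u₁ ℕ.+ u₂ ℕ.+ t₁ ℕ.* s₂) ℕ.* s₃ ℕ.+ (t₁ ℕ.+ t₂) ℕ.* choose₂ s₃
    D = u₁ ℕ.* s₂ ℕ.+ t₁ ℕ.* choose₂ s₂
    identity : ∀ s₂ s₃ t₁ t₂ u₁ u₂ c₂ c₃ →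
      u₂ ℕ.* s₃ ℕ.+ t₂ ℕ.* c₃ ℕ.+ (u₁ ℕ.* (s₂ ℕ.+ s₃) ℕ.+ t₁ ℕ.* (c₂ ℕ.+ c₃ ℕ.+ s₂ ℕ.* s₃)) ≡
      (u₁ ℕ.+ u₂ ℕ.+ t₁ ℕ.* s₂) ℕ.* s₃ ℕ.+ (t₁ ℕ.+ t₂) ℕ.* c₃ ℕ.+ (u₁ ℕ.* s₂ ℕ.+ t₁ ℕ.* c₂)
    identity = ℕ-Solver.solve-∀

  f₂-cocycle : Cocycle (f₂ p)
  f₂-cocycle g h k = begin
    f₂ p h k + f₂ p g (h ∙ k)
      ≈⟨ +-cong (f₂-≈ (~-refl h) (~-refl k)) (f₂-≈ (~-refl g) (~-∙ (~-refl h) (~-refl k))) ⟩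
    A /p + B /p
      ≡⟨ /p+/p-cong A B C D (≡.trans (identity s₂ s₃ t₁ t₂ t₃ u₁ u₂ (choose₂ t₁) (choose₂ t₂))
                                     (cong (λ r → r ℕ.* s₃ ℕ.+ ((t₁ ℕ.+ t₂) ℕ.* s₃ ℕ.+ (u₁ ℕ.+ u₂ ℕ.+ t₁ ℕ.* s₂)) ℕ.* t₃ ℕ.+ D)
                                           (≡.sym (choose₂-+ t₁ t₂)))) ⟩
    C /p + D /p
      ≈⟨ +-cong (f₂-≈ (~-∙ (~-refl g) (~-refl h)) (~-refl k)) (f₂-≈ (~-refl g) (~-refl h)) ⟨
    f₂ p (g ∙ h) k + f₂ p g h ∎
    where
    open ≈-Reasoning
    s₂ s₃ t₁ t₂ t₃ u₁ u₂ A B C D : ℕ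
    s₂ = s[ h ] ; s₃ = s[ k ] ; t₁ = t[ g ] ; t₂ = t[ h ] ; t₃ = t[ k ] ; u₁ = u[ g ] ; u₂ = u[ h ]
    A = choose₂ t₂ ℕ.* s₃ ℕ.+ (t₂ ℕ.* s₃ ℕ.+ u₂) ℕ.* t₃
    B = choose₂ t₁ ℕ.* (s₂ ℕ.+ s₃) ℕ.+ (t₁ ℕ.* (s₂ ℕ.+ s₃) ℕ.+ u₁) ℕ.* (t₂ ℕ.+ t₃)
    C = choose₂ (t₁ ℕ.+ t₂) ℕ.* s₃ ℕ.+ ((t₁ ℕ.+ t₂) ℕ.* s₃ ℕ.+ (u₁ ℕ.+ u₂ ℕ.+ t₁ ℕ.* s₂)) ℕ.* t₃
    D = choose₂ t₁ ℕ.* s₂ ℕ.+ (t₁ ℕ.* s₂ ℕ.+ u₁) ℕ.* t₂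
    identity : ∀ s₂ s₃ t₁ t₂ t₃ u₁ u₂ c₁ c₂ →
      c₂ ℕ.* s₃ ℕ.+ (t₂ ℕ.* s₃ ℕ.+ u₂) ℕ.* t₃ ℕ.+ (c₁ ℕ.* (s₂ ℕ.+ s₃) ℕ.+ (t₁ ℕ.* (s₂ ℕ.+ s₃) ℕ.+ u₁) ℕ.* (t₂ ℕ.+ t₃)) ≡
      (c₁ ℕ.+ c₂ ℕ.+ t₁ ℕ.* t₂) ℕ.* s₃ ℕ.+ ((t₁ ℕ.+ t₂) ℕ.* s₃ ℕ.+ (u₁ ℕ.+ u₂ ℕ.+ t₁ ℕ.* s₂)) ℕ.* t₃ ℕ.+ (c₁ ℕ.* s₂ ℕ.+ (t₁ ℕ.* s₂ ℕ.+ u₁) ℕ.* t₂)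
    identity = ℕ-Solver.solve-∀

  Cocycle-⊕ : ∀ f g → Cocycle f → Cocycle g → Cocycle (f ⊕ g)
  Cocycle-⊕ f g f-cocycle g-cocycle x y z = begin
    (f y z + g y z) + (f x (y ∙ z) + g x (y ∙ z))   ≡⟨ swap (f y z) (g y z) (f x (y ∙ z)) (g x (y ∙ z)) ⟩
    (f y z + f x (y ∙ z)) + (g y z + g x (y ∙ z))   ≈⟨ +-cong (f-cocycle x y z) (g-cocycle x y z) ⟩
    (f (x ∙ y) z + f x y) + (g (x ∙ y) z + g x y)   ≡⟨ swap (f (x ∙ y) z) (f x y) (g (x ∙ y) z) (g x y) ⟩
    (f (x ∙ y) z + g (x ∙ y) z) + (f x y + g x y)   ∎
    where
    open ≈-Reasoning
    swap : ∀ a b c d → (a + b) + (c + d) ≡ (a + c) + (b + d)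
    swap a b c d = solve 4 (λ a b c d → (a :+ b) :+ (c :+ d) := (a :+ c) :+ (b :+ d)) refl a b c d

  Cocycle-⊙ : ∀ k f → Cocycle f → Cocycle (k ⊙ f)
  Cocycle-⊙ k f f-cocycle x y z = begin
    ι k * f y z + ι k * f x (y ∙ z)    ≡⟨ ℚ.*-distribˡ-+ (ι k) (f y z) (f x (y ∙ z)) ⟨
    ι k * (f y z + f x (y ∙ z))        ≈⟨ ι*-cong k (f-cocycle x y z) ⟩
    ι k * (f (x ∙ y) z + f x y)        ≡⟨ ℚ.*-distribˡ-+ (ι k) (f (x ∙ y) z) (f x y) ⟩
    ι k * f (x ∙ y) z + ι k * f x y    ∎
    where open ≈-Reasoning

  bracket : C² p → G p → ℚ
  bracket f g = f c g - f g c

  bracket-⊕ : ∀ f g x → bracket (f ⊕ g) x ≡ bracket f x + bracket g x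
  bracket-⊕ f g x = solve 4 (λ a b c d → (a :+ b) :- (c :+ d) := (a :- c) :+ (b :- d)) refl (f c x) (g c x) (f x c) (g x c)

  bracket-⊙ : ∀ k f x → bracket (k ⊙ f) x ≡ ι k * bracket f x
  bracket-⊙ k f x = solve 3 (λ k a b → k :* a :- k :* b := k :* (a :- b)) refl (ι k) (f c x) (f x c)

  bracket-resp : ∀ {F F′} → (∀ x y → F x y ≈ F′ x y) → ∀ g → bracket F g ≈ bracket F′ g
  bracket-resp F≈F′ g = -‿+-cong (F≈F′ c g) (F≈F′ g c)

  ∂ : C² p → G p → G p → G p → ℚ
  ∂ f x y z = (f y z + f x (y ∙ z)) - (f (x ∙ y) z + f x y)

  bracket-∙ : ∀ f → Cocycle f → ∀ x y → bracket f (x ∙ y) ≈ bracket f x + bracket f y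
  bracket-∙ f f-cocycle x y = begin
    bracket f (x ∙ y)                                                   ≡⟨ defects ⟩
    (bracket f x + bracket f y) + ((∂ f c x y - ∂ f x c y) + ∂ f x y c)  ≈⟨ +-cong (≈-refl {bracket f x + bracket f y}) defects≈0 ⟩
    (bracket f x + bracket f y) + ((0ℚ - 0ℚ) + 0ℚ)                      ≡⟨ ℚ.+-identityʳ (bracket f x + bracket f y) ⟩
    bracket f x + bracket f y                                           ∎
    where
    open ≈-Reasoning
    defects≈0 : (∂ f c x y - ∂ f x c y) + ∂ f x y c ≈ (0ℚ - 0ℚ) + 0ℚ
    defects≈0 = +-cong (-‿+-cong (x≈y⇒x-y≈0 (f-cocycle c x y)) (x≈y⇒x-y≈0 (f-cocycle x c y))) (x≈y⇒x-y≈0 (f-cocycle x y c))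
    defects : bracket f (x ∙ y) ≡ (bracket f x + bracket f y) + ((∂ f c x y - ∂ f x c y) + ∂ f x y c)
    defects rewrite c-central x | c-central y =
      solve 9 (λ cxy xyc cx xc cy yc xy xc·y x·yc →
                 cxy :- xyc
              := (cx :- xc :+ (cy :- yc))
                 :+ ((((xy :+ cxy) :- (xc·y :+ cx)) :- ((cy :+ x·yc) :- (xc·y :+ xc)))
                    :+ ((yc :+ x·yc) :- (xyc :+ xy))))
              refl (f c (x ∙ y)) (f (x ∙ y) c) (f c x) (f x c) (f c y) (f y c) (f x y) (f (x ∙ c) y) (f x (y ∙ c))

  bracket-1 : ∀ f → Cocycle f → bracket f 1ᴳ ≈ 0ℚ
  bracket-1 f f-cocycle = +-cancelˡ (bracket f 1ᴳ) (begin
    bracket f 1ᴳ + bracket f 1ᴳ     ≈⟨ bracket-∙ f f-cocycle 1ᴳ 1ᴳ ⟨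
    bracket f (1ᴳ ∙ 1ᴳ)             ≡⟨ cong (bracket f) (∙-identityˡ 1ᴳ) ⟩
    bracket f 1ᴳ                    ≡⟨ ℚ.+-identityʳ (bracket f 1ᴳ) ⟨
    bracket f 1ᴳ + 0ℚ               ∎)
    where open ≈-Reasoning

  bracket-^ : ∀ f → Cocycle f → ∀ x n → bracket f (x ^ᴳ n) ≈ ι (+ n) * bracket f x
  bracket-^ f f-cocycle x zero    = ≈-trans (bracket-1 f f-cocycle) (≡⇒≈ (≡.sym (ℚ.*-zeroˡ (bracket f x))))
  bracket-^ f f-cocycle x (suc n) = begin
    bracket f (x ∙ x ^ᴳ n)                    ≈⟨ bracket-∙ f f-cocycle x (x ^ᴳ n) ⟩
    bracket f x + bracket f (x ^ᴳ n)          ≈⟨ +-cong (≈-refl {bracket f x}) (bracket-^ f f-cocycle x n) ⟩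
    bracket f x + ι (+ n) * bracket f x      ≡⟨ solve 2 (λ β n → β :+ n :* β := (con 1ℚ :+ n) :* β) refl (bracket f x) (ι (+ n)) ⟩
    (1ℚ + ι (+ n)) * bracket f x             ≡⟨ cong (_* bracket f x) (ι-homo-+ (+ 1) (+ n)) ⟨
    ι (+ suc n) * bracket f x                ∎
    where open ≈-Reasoning

  bracket-torsion : ∀ f → Cocycle f → ∀ x → Σ[ z ∈ ℤ ] bracket f x ≡ ι z * 1/p
  bracket-torsion f f-cocycle x = _≈_.integer pβ≈0 , (begin
    β                        ≡⟨ ℚ.*-identityʳ β ⟨
    β * 1ℚ                   ≡⟨ cong (β *_) (ιd*1/d≡1 p) ⟨
    β * (ι (+ p) * 1/p)      ≡⟨ solve 3 (λ β P I → β :* (P :* I) := (P :* β :- con 0ℚ) :* I) refl β (ι (+ p)) 1/p ⟩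
    (ι (+ p) * β - 0ℚ) * 1/p ≡⟨ cong (_* 1/p) (_≈_.x-y≡integer pβ≈0) ⟩
    ι (_≈_.integer pβ≈0) * 1/p ∎)
    where
    open ≡.≡-Reasoning
    β : ℚ
    β = bracket f x
    pβ≈0 : ι (+ p) * β ≈ 0ℚ
    pβ≈0 = ≈-trans (≈-sym (bracket-^ f f-cocycle x p)) (≈-trans (≡⇒≈ (cong (bracket f) (^ᴳ-p x))) (bracket-1 f f-cocycle))

  bracket-f₁ : ∀ {x s t u} → x ~ (s , t , u) → bracket (f₁ p) x ≈ s /p
  bracket-f₁ {x} {s} {t} {u} x~ = begin
    f₁ p c x - f₁ p x c                                  ≈⟨ -‿+-cong (f₁-≈ ~-c x~) (f₁-≈ x~ ~-c) ⟩
    (1 ℕ.* s ℕ.+ 0 ℕ.* choose₂ s) /p - (u ℕ.* 0 ℕ.+ t ℕ.* 0) /p  ≡⟨ cong₂ (λ m n → m /p - n /p) (evaluate₁ s (choose₂ s)) (evaluate₀ u t) ⟩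
    s /p - 0 /p                                          ≡⟨ cong (s /p -_) (ℚ.0/n≡0 p) ⟩
    s /p - 0ℚ                                            ≡⟨ ℚ.+-identityʳ (s /p) ⟩
    s /p                                                 ∎
    where
    open ≈-Reasoning
    evaluate₁ : ∀ s c → 1 ℕ.* s ℕ.+ 0 ℕ.* c ≡ s
    evaluate₁ = ℕ-Solver.solve-∀
    evaluate₀ : ∀ u t → u ℕ.* 0 ℕ.+ t ℕ.* 0 ≡ 0
    evaluate₀ = ℕ-Solver.solve-∀

  bracket-f₂ : ∀ {x s t u} → x ~ (s , t , u) → bracket (f₂ p) x ≈ t /p
  bracket-f₂ {x} {s} {t} {u} x~ = begin
    f₂ p c x - f₂ p x c                                  ≈⟨ -‿+-cong (f₂-≈ ~-c x~) (f₂-≈ x~ ~-c) ⟩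
    (0 ℕ.* s ℕ.+ (0 ℕ.* s ℕ.+ 1) ℕ.* t) /p - (choose₂ t ℕ.* 0 ℕ.+ (t ℕ.* 0 ℕ.+ u) ℕ.* 0) /p
                                                         ≡⟨ cong₂ (λ m n → m /p - n /p) (evaluate₁ s t) (evaluate₀ (choose₂ t) t u) ⟩
    t /p - 0 /p                                          ≡⟨ cong (t /p -_) (ℚ.0/n≡0 p) ⟩
    t /p - 0ℚ                                            ≡⟨ ℚ.+-identityʳ (t /p) ⟩
    t /p                                                 ∎
    where
    open ≈-Reasoning
    evaluate₁ : ∀ s t → 0 ℕ.* s ℕ.+ (0 ℕ.* s ℕ.+ 1) ℕ.* t ≡ t
    evaluate₁ = ℕ-Solver.solve-∀
    evaluate₀ : ∀ c t u → c ℕ.* 0 ℕ.+ (t ℕ.* 0 ℕ.+ u) ℕ.* 0 ≡ 0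
    evaluate₀ = ℕ-Solver.solve-∀

  CoboundaryOn⇒bracket≈0 : ∀ {H f x} → CoboundaryOn′ H f → H c → H x → bracket f x ≈ 0ℚ
  CoboundaryOn⇒bracket≈0 {H} {f} {x} (φ , f≈δφ) Hc Hx = begin
    f c x - f x c
      ≈⟨ -‿+-cong (f≈δφ Hc Hx) (f≈δφ Hx Hc) ⟩
    (φ c + φ x - φ (c ∙ x)) - (φ x + φ c - φ (x ∙ c))
      ≡⟨ cong (λ y → (φ c + φ x - φ y) - (φ x + φ c - φ (x ∙ c))) (c-central x) ⟩
    (φ c + φ x - φ (x ∙ c)) - (φ x + φ c - φ (x ∙ c))
      ≡⟨ solve 3 (λ a b d → (a :+ b :- d) :- (b :+ a :- d) := con 0ℚ) refl (φ c) (φ x) (φ (x ∙ c)) ⟩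
    0ℚ                                                          ∎
    where open ≈-Reasoning

  Coboundary⇒bracket≈0 : ∀ {F} → Coboundary F → ∀ x → bracket F x ≈ 0ℚ
  Coboundary⇒bracket≈0 {F} F-coboundary x =
    CoboundaryOn⇒bracket≈0 {H = λ _ → ⊤} (Coboundary⇒CoboundaryOn′ F-coboundary) tt tt

module Extension (p : ℕ) .{{_ : NonZero p}} (p∣choose₂p : p ∣ℕ choose₂ p)
                 (f : C² p) (f-cocycle : Cochains.Cocycle p p∣choose₂p f) where

  open import Data.List using (_∷_; [])
  open import Data.List.Membership.Propositional using (_∈_)
  open import Data.List.Relation.Unary.Any using (here; there)
  open import Data.Nat as ℕ using (zero; suc; _%_)
  import Data.Nat.Properties as ℕ
  import Data.Nat.Tactic.RingSolver as ℕ-Solver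
  open import Data.Integer using (+_)
  open import Data.Rational as ℚ using (ℚ; 0ℚ; 1ℚ; _+_; _*_; _-_; -_)
  import Data.Rational.Properties as ℚ
  open import Data.Rational.Solver using (module +-*-Solver)
  open import Data.Product using (Σ-syntax; _×_; _,_; proj₁; proj₂)
  open import Function using (_∘_)
  import Relation.Binary.Reasoning.Setoid as SetoidReasoning
  open import Relation.Binary.PropositionalEquality as ≡ using (_≡_; refl; cong; cong₂)

  open ModularArithmetic p
  open Model p p∣choose₂p
  open Cochains p p∣choose₂p
  open ℚ/ℤ
  open +-*-Solver

  E : Set
  E = G p × ℚ

  π : E → G p
  π = proj₁

  infix 4 _≋_
  record _≋_ (A B : E) : Set where
    constructor _,_
    field
      π-≡ : π A ≡ π B
      scalar-≈ : proj₂ A ≈ proj₂ B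

  infixl 7 _⊗_
  _⊗_ : E → E → E
  (g , x) ⊗ (h , y) = g ∙ h , x + y + f g h

  1ᴱ : E
  1ᴱ = 1ᴳ , - f 1ᴳ 1ᴳ

  f-1ˡ : ∀ g → f 1ᴳ g ≈ f 1ᴳ 1ᴳ
  f-1ˡ g = +-cancelˡ (f 1ᴳ g) (begin
    f 1ᴳ g + f 1ᴳ g              ≡⟨ cong (λ h → f 1ᴳ g + f 1ᴳ h) (∙-identityˡ g) ⟨
    f 1ᴳ g + f 1ᴳ (1ᴳ ∙ g)       ≈⟨ f-cocycle 1ᴳ 1ᴳ g ⟩
    f (1ᴳ ∙ 1ᴳ) g + f 1ᴳ 1ᴳ      ≡⟨ cong (λ h → f h g + f 1ᴳ 1ᴳ) (∙-identityˡ 1ᴳ) ⟩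
    f 1ᴳ g + f 1ᴳ 1ᴳ             ∎)
    where open ≈-Reasoning

  f-1ʳ : ∀ g → f g 1ᴳ ≈ f 1ᴳ 1ᴳ
  f-1ʳ g = ≈-sym (+-cancelˡ (f g 1ᴳ) (begin
    f g 1ᴳ + f 1ᴳ 1ᴳ             ≡⟨ ℚ.+-comm (f g 1ᴳ) (f 1ᴳ 1ᴳ) ⟩
    f 1ᴳ 1ᴳ + f g 1ᴳ             ≡⟨ cong (λ h → f 1ᴳ 1ᴳ + f g h) (∙-identityˡ 1ᴳ) ⟨
    f 1ᴳ 1ᴳ + f g (1ᴳ ∙ 1ᴳ)      ≈⟨ f-cocycle g 1ᴳ 1ᴳ ⟩
    f (g ∙ 1ᴳ) 1ᴳ + f g 1ᴳ       ≡⟨ cong (λ h → f h 1ᴳ + f g 1ᴳ) (∙-identityʳ g) ⟩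
    f g 1ᴳ + f g 1ᴳ              ∎))
    where open ≈-Reasoning

  ≋-refl : ∀ {A} → A ≋ A
  ≋-refl = refl , ≈-refl

  ≋-sym : ∀ {A B} → A ≋ B → B ≋ A
  ≋-sym (π-≡ , scalar-≈) = ≡.sym π-≡ , ≈-sym scalar-≈

  ≋-trans : ∀ {A B C} → A ≋ B → B ≋ C → A ≋ C
  ≋-trans (π-≡₁ , scalar-≈₁) (π-≡₂ , scalar-≈₂) = ≡.trans π-≡₁ π-≡₂ , ≈-trans scalar-≈₁ scalar-≈₂

  ≡⇒≋ : ∀ {A B} → A ≡ B → A ≋ B
  ≡⇒≋ refl = ≋-refl

  ⊗-cong : ∀ {A A′ B B′} → A ≋ A′ → B ≋ B′ → A ⊗ B ≋ A′ ⊗ B′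
  ⊗-cong (refl , x≈x′) (refl , y≈y′) = refl , +-cong (+-cong x≈x′ y≈y′) ≈-refl

  ⊗-assoc : ∀ A B C → (A ⊗ B) ⊗ C ≋ A ⊗ (B ⊗ C)
  ⊗-assoc (g , x) (h , y) (k , z) = ∙-assoc g h k , (begin
    x + y + f g h + z + f (g ∙ h) k
      ≡⟨ solve 5 (λ x y z a b → x :+ y :+ a :+ z :+ b := (x :+ y :+ z) :+ (b :+ a)) refl x y z (f g h) (f (g ∙ h) k) ⟩
    (x + y + z) + (f (g ∙ h) k + f g h)
      ≈⟨ +-cong (≈-refl {x + y + z}) (f-cocycle g h k) ⟨
    (x + y + z) + (f h k + f g (h ∙ k))
      ≡⟨ solve 5 (λ x y z c d → (x :+ y :+ z) :+ (c :+ d) := x :+ (y :+ z :+ c) :+ d) refl x y z (f h k) (f g (h ∙ k)) ⟩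
    x + (y + z + f h k) + f g (h ∙ k)    ∎)
    where open ≈-Reasoning

  ⊗-identityˡ : ∀ A → 1ᴱ ⊗ A ≋ A
  ⊗-identityˡ (g , x) = ∙-identityˡ g , (begin
    - f 1ᴳ 1ᴳ + x + f 1ᴳ g        ≈⟨ +-cong (≈-refl { - f 1ᴳ 1ᴳ + x}) (f-1ˡ g) ⟩
    - f 1ᴳ 1ᴳ + x + f 1ᴳ 1ᴳ       ≡⟨ solve 2 (λ a x → :- a :+ x :+ a := x) refl (f 1ᴳ 1ᴳ) x ⟩
    x                             ∎)
    where open ≈-Reasoning

  ⊗-identityʳ : ∀ A → A ⊗ 1ᴱ ≋ A
  ⊗-identityʳ (g , x) = ∙-identityʳ g , (begin
    x + - f 1ᴳ 1ᴳ + f g 1ᴳ        ≈⟨ +-cong (≈-refl {x + - f 1ᴳ 1ᴳ}) (f-1ʳ g) ⟩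
    x + - f 1ᴳ 1ᴳ + f 1ᴳ 1ᴳ       ≡⟨ solve 2 (λ a x → x :+ :- a :+ a := x) refl (f 1ᴳ 1ᴳ) x ⟩
    x                             ∎)
    where open ≈-Reasoning

  E-monoid : Monoid _ _
  E-monoid = record
    { Carrier = E ; _≈_ = _≋_ ; _∙_ = _⊗_ ; ε = 1ᴱ
    ; isMonoid = record
      { isSemigroup = record
        { isMagma = record
          { isEquivalence = record { refl = ≋-refl ; sym = ≋-sym ; trans = ≋-trans }
          ; ∙-cong = ⊗-cong }
        ; assoc = ⊗-assoc }
      ; identity = ⊗-identityˡ , ⊗-identityʳ } }

  module ≋-Reasoning = SetoidReasoning (Monoid.setoid E-monoid)

  open MonoidPowers E-monoid
    using (_^_; ^-+; ^-cong-%; Commute; commuting-words; module HeisenbergWords)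

  π-^ : ∀ A n → π (A ^ n) ≡ π A ^ᴳ n
  π-^ A zero    = refl
  π-^ A (suc n) = cong (π A ∙_) (π-^ A n)

  scalar-^ : ∀ g r n → proj₂ ((g , r) ^ n) ≡ ι (+ n) * r + proj₂ ((g , 0ℚ) ^ n)
  scalar-^ g r zero    = solve 2 (λ r a → a := con 0ℚ :* r :+ a) refl r (- f 1ᴳ 1ᴳ)
  scalar-^ g r (suc n) = begin
    r + proj₂ ((g , r) ^ n) + f g (π ((g , r) ^ n))
      ≡⟨ cong₂ (λ x h → r + x + f g h) (scalar-^ g r n) (≡.trans (π-^ (g , r) n) (≡.sym (π-^ (g , 0ℚ) n))) ⟩
    r + (ι (+ n) * r + S) + f g (π ((g , 0ℚ) ^ n))
      ≡⟨ solve 4 (λ r n S F → r :+ (n :* r :+ S) :+ F := (con 1ℚ :+ n) :* r :+ (con 0ℚ :+ S :+ F)) refl r (ι (+ n)) S (f g (π ((g , 0ℚ) ^ n))) ⟩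
    (1ℚ + ι (+ n)) * r + (0ℚ + S + f g (π ((g , 0ℚ) ^ n)))
      ≡⟨ cong (λ k → k * r + (0ℚ + S + f g (π ((g , 0ℚ) ^ n)))) (ι-homo-+ (+ 1) (+ n)) ⟨
    ι (+ suc n) * r + proj₂ ((g , 0ℚ) ^ suc n)               ∎
    where
    open ≡.≡-Reasoning
    S : ℚ
    S = proj₂ ((g , 0ℚ) ^ n)

  -- The scalar is chosen so that the p-th power of the lift is exactly 1ᴱ.
  lift : G p → E
  lift g = g , (- f 1ᴳ 1ᴳ - proj₂ ((g , 0ℚ) ^ p)) * 1/p

  lift-^p : ∀ g → lift g ^ p ≋ 1ᴱ
  lift-^p g = ≡.trans (π-^ (lift g) p) (^ᴳ-p g) , ≡⇒≈ (begin
    proj₂ (lift g ^ p)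
      ≡⟨ scalar-^ g r p ⟩
    ι (+ p) * ((- f 1ᴳ 1ᴳ - S) * 1/p) + S
      ≡⟨ solve 4 (λ P a S I → P :* ((:- a :- S) :* I) :+ S := (:- a :- S) :* (P :* I) :+ S) refl (ι (+ p)) (f 1ᴳ 1ᴳ) S 1/p ⟩
    (- f 1ᴳ 1ᴳ - S) * (ι (+ p) * 1/p) + S
      ≡⟨ cong (λ k → (- f 1ᴳ 1ᴳ - S) * k + S) (ιd*1/d≡1 p) ⟩
    (- f 1ᴳ 1ᴳ - S) * 1ℚ + S
      ≡⟨ solve 2 (λ a S → (:- a :- S) :* con 1ℚ :+ S := :- a) refl (f 1ᴳ 1ᴳ) S ⟩
    - f 1ᴳ 1ᴳ                                    ∎)
    where
    open ≡.≡-Reasoning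
    r S : ℚ
    r = (- f 1ᴳ 1ᴳ - proj₂ ((g , 0ℚ) ^ p)) * 1/p
    S = proj₂ ((g , 0ℚ) ^ p)

  ⊗-cancelˡ : ∀ A B → A ⊗ B ≋ A → π B ≡ 1ᴳ → B ≋ 1ᴱ
  ⊗-cancelˡ (g , x) (h , y) (_ , x+y+F≈x) refl = refl , (begin
    y                            ≡⟨ solve 3 (λ x y F → y := (x :+ y :+ F) :- x :- F) refl x y (f g 1ᴳ) ⟩
    (x + y + f g 1ᴳ) - x - f g 1ᴳ  ≈⟨ -‿+-cong (-‿+-cong x+y+F≈x (≈-refl {x})) (f-1ʳ g) ⟩
    x - x - f 1ᴳ 1ᴳ              ≡⟨ solve 2 (λ x a → x :- x :- a := :- a) refl x (f 1ᴳ 1ᴳ) ⟩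
    - f 1ᴳ 1ᴳ                    ∎)
    where open ≈-Reasoning

  c-commute : ∀ {g} → bracket f g ≈ 0ℚ → ∀ r r′ → Commute (c , r) (g , r′)
  c-commute {g} bracket≈0 r r′ = c-central g , (begin
    r + r′ + f c g     ≈⟨ +-cong (≡⇒≈ (ℚ.+-comm r r′)) (x-y≈0⇒x≈y bracket≈0) ⟩
    r′ + r + f g c     ∎)
    where open ≈-Reasoning

  Image : ∀ {I : Set} → (I → E) → G p → Set
  Image {I} w g = Σ[ i ∈ I ] g ≡ π (w i)

  -- If the elements of H are the images of a family of elements of E closed under ⊗, a
  -- section σ of π that inverts π on the family splits the extension over H.
  module Section {I : Set} (w : I → E) (_⊕ᵢ_ : I → I → I) (w-⊗ : ∀ i j → w i ⊗ w j ≋ w (i ⊕ᵢ j))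
                 (σ : G p → E) (σ-w : ∀ i → σ (π (w i)) ≋ w i) where

    Image-∙ : ∀ {x y} → Image w x → Image w y → Image w (x ∙ y)
    Image-∙ (i , refl) (j , refl) = i ⊕ᵢ j , _≋_.π-≡ (w-⊗ i j)

    CoboundaryOn-Image : CoboundaryOn′ (Image w) f
    CoboundaryOn-Image = φ , f≈δφ
      where
      φ : G p → ℚ
      φ g = - proj₂ (σ g)
      f≈δφ : ∀ {x y} → Image w x → Image w y → f x y ≈ φ x + φ y - φ (x ∙ y)
      f≈δφ {x} {y} (i , refl) (j , refl) = begin
        f x y
          ≡⟨ cong₂ f (_≋_.π-≡ (σ-w i)) (_≋_.π-≡ (σ-w j)) ⟨
        f (π (σ x)) (π (σ y))
          ≡⟨ solve 3 (λ a b F → F := (a :+ b :+ F) :- a :- b) refl (proj₂ (σ x)) (proj₂ (σ y)) (f (π (σ x)) (π (σ y))) ⟩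
        proj₂ (σ x ⊗ σ y) - proj₂ (σ x) - proj₂ (σ y)
          ≈⟨ -‿+-cong (-‿+-cong (_≋_.scalar-≈ σx⊗σy≋σxy) (≈-refl {proj₂ (σ x)})) (≈-refl {proj₂ (σ y)}) ⟩
        proj₂ (σ (x ∙ y)) - proj₂ (σ x) - proj₂ (σ y)
          ≡⟨ solve 3 (λ a b d → d :- a :- b := (:- a) :+ (:- b) :- (:- d)) refl (proj₂ (σ x)) (proj₂ (σ y)) (proj₂ (σ (x ∙ y))) ⟩
        φ x + φ y - φ (x ∙ y)                                  ∎
        where
        open ≈-Reasoning
        σx⊗σy≋σxy : σ x ⊗ σ y ≋ σ (x ∙ y)
        σx⊗σy≋σxy = ≋-trans (⊗-cong (σ-w i) (σ-w j)) (≋-trans (w-⊗ i j)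
                      (≋-trans (≋-sym (σ-w (i ⊕ᵢ j))) (≡⇒≋ (cong σ (≡.sym (_≋_.π-≡ (w-⊗ i j)))))))

    CoboundaryOn-⟪⟫ : ∀ {S} i₀ → π (w i₀) ≡ 1ᴳ → (∀ {x} → x ∈ S → Image w x) → CoboundaryOn′ (⟪_⟫ p S) f
    CoboundaryOn-⟪⟫ i₀ π[wi₀]≡1 S⊆Image =
      CoboundaryOn′-mono (⟪⟫-ind (Image w) (i₀ , ≡.sym π[wi₀]≡1) Image-∙ S⊆Image) CoboundaryOn-Image

  CoboundaryOn-cyclic : ∀ g (log : G p → ℕ) → (∀ M → log (g ^ᴳ M) ≡ₚ M) → CoboundaryOn′ (⟪_⟫ p (g ∷ [])) f
  CoboundaryOn-cyclic g log log-^ =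
    CoboundaryOn-⟪⟫ 0 refl λ { (here refl) → 1 , ≡.sym (∙-identityʳ g) }
    where
    w : ℕ → E
    w M = lift g ^ M
    w-⊗ : ∀ M N → w M ⊗ w N ≋ w (M ℕ.+ N)
    w-⊗ M N = ≋-sym (^-+ (lift g) M N)
    σ-w : ∀ M → w (log (π (w M))) ≋ w M
    σ-w M = ^-cong-% p (lift-^p g) (≡.trans (cong (λ x → log x % p) (π-^ (lift g) M)) (log-^ M))
    open Section w ℕ._+_ w-⊗ (w ∘ log) σ-w

  CoboundaryOn-⟨g,c⟩ : ∀ g → bracket f g ≈ 0ℚ → (log₁ log₂ : G p → ℕ) →
                       (∀ M N → log₁ (g ^ᴳ M ∙ c ^ᴳ N) ≡ₚ M) → (∀ M N → log₂ (g ^ᴳ M ∙ c ^ᴳ N) ≡ₚ N) →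
                       CoboundaryOn′ (⟪_⟫ p (g ∷ c ∷ [])) f
  CoboundaryOn-⟨g,c⟩ g bracket≈0 log₁ log₂ log₁-w log₂-w =
    CoboundaryOn-⟪⟫ (0 , 0) (∙-identityˡ 1ᴳ) λ
      { (here refl)         → (1 , 0) , ≡.sym (≡.trans (∙-identityʳ (g ∙ 1ᴳ)) (∙-identityʳ g))
      ; (there (here refl)) → (0 , 1) , ≡.sym (≡.trans (∙-identityˡ (c ∙ 1ᴳ)) (∙-identityʳ c)) }
    where
    X Y : E
    X = lift g
    Y = lift c
    w : ℕ × ℕ → E
    w (M , N) = X ^ M ⊗ Y ^ N
    _⊕ᵢ_ : ℕ × ℕ → ℕ × ℕ → ℕ × ℕ
    (M , N) ⊕ᵢ (M′ , N′) = M ℕ.+ M′ , N ℕ.+ N′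
    w-⊗ : ∀ i j → w i ⊗ w j ≋ w (i ⊕ᵢ j)
    w-⊗ (M , N) (M′ , N′) = commuting-words (≋-sym (c-commute bracket≈0 (proj₂ Y) (proj₂ X))) M N M′ N′
    π-w : ∀ M N → π (w (M , N)) ≡ g ^ᴳ M ∙ c ^ᴳ N
    π-w M N = cong₂ _∙_ (π-^ X M) (π-^ Y N)
    σ-w : ∀ i → w (log₁ (π (w i)) , log₂ (π (w i))) ≋ w i
    σ-w (M , N) = ⊗-cong (^-cong-% p (lift-^p g) (≡.trans (cong (λ x → log₁ x % p) (π-w M N)) (log₁-w M N)))
                         (^-cong-% p (lift-^p c) (≡.trans (cong (λ x → log₂ x % p) (π-w M N)) (log₂-w M N)))
    σ : G p → E
    σ x = w (log₁ x , log₂ x)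
    open Section w _⊕ᵢ_ w-⊗ σ σ-w

  -- Z is chosen so that Y ⊗ X ≋ (X ⊗ Y) ⊗ Z holds on the nose; the words X^M Y^N Z^O then
  -- multiply like the elements a^M b^N c^O of G.
  module Splitting (bracket[a]≈0 : bracket f a ≈ 0ℚ) (bracket[b]≈0 : bracket f b ≈ 0ℚ) where

    X Y Z : E
    X = lift a
    Y = lift b
    Z = c , f b a - f a b - f (a ∙ b) c

    YX≋XYZ : Y ⊗ X ≋ (X ⊗ Y) ⊗ Z ^ 1
    YX≋XYZ = ≋-trans (b∙a≡a∙b∙c , ≡⇒≈ (solve 5 (λ x y ba ab abc → y :+ x :+ ba := x :+ y :+ ab :+ (ba :- ab :- abc) :+ abc) refl
                                              (proj₂ X) (proj₂ Y) (f b a) (f a b) (f (a ∙ b) c)))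
                     (⊗-cong (≋-refl {X ⊗ Y}) (≋-sym (⊗-identityʳ Z)))

    open HeisenbergWords X Y Z 1 (c-commute bracket[a]≈0 (proj₂ Z) (proj₂ X)) (c-commute bracket[b]≈0 (proj₂ Z) (proj₂ Y)) YX≋XYZ

    -- Y^p X = X Y^p Z^p, and Y^p ≋ 1ᴱ.
    Z^p≋1 : Z ^ p ≋ 1ᴱ
    Z^p≋1 = ⊗-cancelˡ (X ^ 1) (Z ^ p) X≋XZ^p (≡.trans (π-^ Z p) (^ᴳ-p c))
      where
      open ≋-Reasoning
      X≋XZ^p : X ^ 1 ⊗ Z ^ p ≋ X ^ 1
      X≋XZ^p = begin
        X ^ 1 ⊗ Z ^ p                           ≈⟨ ⊗-cong (⊗-identityʳ (X ^ 1)) (≡⇒≋ (cong (Z ^_) (ℕ.*-identityʳ p))) ⟨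
        (X ^ 1 ⊗ 1ᴱ) ⊗ Z ^ (p ℕ.* (1 ℕ.* 1))     ≈⟨ ⊗-cong (⊗-cong (≋-refl {X ^ 1}) (lift-^p b)) (≋-refl {Z ^ (p ℕ.* (1 ℕ.* 1))}) ⟨
        (X ^ 1 ⊗ Y ^ p) ⊗ Z ^ (p ℕ.* (1 ℕ.* 1))  ≈⟨ y^∙x^ p 1 ⟨
        Y ^ p ⊗ X ^ 1                           ≈⟨ ⊗-cong (lift-^p b) (≋-refl {X ^ 1}) ⟩
        1ᴱ ⊗ X ^ 1                              ≈⟨ ⊗-identityˡ (X ^ 1) ⟩
        X ^ 1                                   ∎

    _⊕ᵢ_ : ℕ × ℕ × ℕ → ℕ × ℕ × ℕ → ℕ × ℕ × ℕ
    (M , N , O) ⊕ᵢ (M′ , N′ , O′) = M ℕ.+ M′ , N ℕ.+ N′ , N ℕ.* (1 ℕ.* M′) ℕ.+ (O ℕ.+ O′)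

    w : ℕ × ℕ × ℕ → E
    w (M , N , O) = word M N O

    w-⊗ : ∀ i j → w i ⊗ w j ≋ w (i ⊕ᵢ j)
    w-⊗ (M , N , O) (M′ , N′ , O′) = word-∙ M N O M′ N′ O′

    π-w~ : ∀ i → π (w i) ~ i
    π-w~ (M , N , O) = ≡.subst (_~ (M , N , O)) (≡.sym π-word)
      (~-resp (~-∙ (~-∙ (~-^ ~-a M) (~-^ ~-b N)) (~-^ ~-c O))
        (≡⇒≡ₚ (s-exponent M N O)) (≡⇒≡ₚ (t-exponent M N O))
        (≡⇒≡ₚ (u-exponent M N O (choose₂ M) (choose₂ N) (choose₂ O))))
      where
      π-word : π (word M N O) ≡ (a ^ᴳ M ∙ b ^ᴳ N) ∙ c ^ᴳ O
      π-word = cong₂ _∙_ (cong₂ _∙_ (π-^ X M) (π-^ Y N)) (π-^ Z O)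
      s-exponent : ∀ M N O → M ℕ.* 1 ℕ.+ N ℕ.* 0 ℕ.+ O ℕ.* 0 ≡ M
      s-exponent = ℕ-Solver.solve-∀
      t-exponent : ∀ M N O → M ℕ.* 0 ℕ.+ N ℕ.* 1 ℕ.+ O ℕ.* 0 ≡ N
      t-exponent = ℕ-Solver.solve-∀
      u-exponent : ∀ M N O cM cN cO →
        M ℕ.* 0 ℕ.+ 0 ℕ.* 1 ℕ.* cM ℕ.+ (N ℕ.* 0 ℕ.+ 1 ℕ.* 0 ℕ.* cN) ℕ.+ M ℕ.* 0 ℕ.* (N ℕ.* 0)
          ℕ.+ (O ℕ.* 1 ℕ.+ 0 ℕ.* 0 ℕ.* cO) ℕ.+ (M ℕ.* 0 ℕ.+ N ℕ.* 1) ℕ.* (O ℕ.* 0) ≡ O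
      u-exponent = ℕ-Solver.solve-∀

    σ : G p → E
    σ x = w (s[ x ] , t[ x ] , u[ x ])

    σ-w : ∀ i → σ (π (w i)) ≋ w i
    σ-w i = ⊗-cong (⊗-cong (^-cong-% p (lift-^p a) (proj₁ (π-w~ i))) (^-cong-% p (lift-^p b) (proj₁ (proj₂ (π-w~ i)))))
                   (^-cong-% p Z^p≋1 (proj₂ (proj₂ (π-w~ i))))

    everything-is-a-word : ∀ x → Image w x
    everything-is-a-word x = (s[ x ] , t[ x ] , u[ x ]) , ~-unique (~-refl x) (π-w~ (s[ x ] , t[ x ] , u[ x ]))

    open Section w _⊕ᵢ_ w-⊗ σ σ-w public

  bracket≈0⇒Coboundary : bracket f a ≈ 0ℚ → bracket f b ≈ 0ℚ → Coboundary f
  bracket≈0⇒Coboundary bracket[a]≈0 bracket[b]≈0 =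
    proj₁ CoboundaryOn-Image , λ x y → proj₂ CoboundaryOn-Image (everything-is-a-word x) (everything-is-a-word y)
    where open Splitting bracket[a]≈0 bracket[b]≈0

module Kernels (p : ℕ) .{{_ : NonZero p}} (p∣choose₂p : p ∣ℕ choose₂ p) where

  open import Data.List using (_∷_; [])
  open import Data.List.Relation.Unary.Any using (here; there)
  import Data.Nat as ℕ
  open import Data.Integer as ℤ using (ℤ; +_)
  import Data.Integer.Properties as ℤ
  open import Data.Integer.Divisibility.Signed using (_∣_; ∣m⇒∣-m)
  import Data.Integer.Tactic.RingSolver as ℤ-Solver
  open import Data.Rational as ℚ using (ℚ; 0ℚ; 1ℚ; _+_; _*_; _-_; -_)
  import Data.Rational.Properties as ℚ
  open import Data.Rational.Solver using (module +-*-Solver)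
  open import Data.Product using (Σ-syntax; _×_; _,_; proj₁; proj₂)
  open import Relation.Binary.PropositionalEquality as ≡ using (_≡_; refl; cong; cong₂)

  open ModularArithmetic p
  open Model p p∣choose₂p
  open Cochains p p∣choose₂p
  open ℚ/ℤ
  open +-*-Solver

  infix 7 _·f₁+_·f₂
  _·f₁+_·f₂ : ℤ → ℤ → C² p
  x ·f₁+ y ·f₂ = x ⊙ f₁ p ⊕ y ⊙ f₂ p

  InSpan′ : C² p → Set
  InSpan′ f = Σ[ x ∈ ℤ ] Σ[ y ∈ ℤ ] Coboundary (f ⊕ ((ℤ.- x) ·f₁+ (ℤ.- y) ·f₂))

  InCyclic′ : C² p → C² p → Set
  InCyclic′ h f = Σ[ k ∈ ℤ ] Coboundary (f ⊕ (ℤ.- k) ⊙ h)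

  Kernel′ : (G p → Set) → (C² p → Set) → Set
  Kernel′ H P = ∀ f → Cocycle f → (CoboundaryOn′ H f → P f) × (P f → CoboundaryOn′ H f)

  ·f₁+·f₂-cocycle : ∀ x y → Cocycle (x ·f₁+ y ·f₂)
  ·f₁+·f₂-cocycle x y = Cocycle-⊕ (x ⊙ f₁ p) (y ⊙ f₂ p) (Cocycle-⊙ x (f₁ p) f₁-cocycle) (Cocycle-⊙ y (f₂ p) f₂-cocycle)

  bracket-·f₁+·f₂ : ∀ x y {g s t u} → g ~ (s , t , u) → bracket (x ·f₁+ y ·f₂) g ≈ ι (x ℤ.* + s ℤ.+ y ℤ.* + t) * 1/p
  bracket-·f₁+·f₂ x y {g} {s} {t} {u} g~ = begin
    bracket (x ·f₁+ y ·f₂) g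
      ≡⟨ bracket-⊕ (x ⊙ f₁ p) (y ⊙ f₂ p) g ⟩
    bracket (x ⊙ f₁ p) g + bracket (y ⊙ f₂ p) g
      ≡⟨ cong₂ _+_ (bracket-⊙ x (f₁ p) g) (bracket-⊙ y (f₂ p) g) ⟩
    ι x * bracket (f₁ p) g + ι y * bracket (f₂ p) g
      ≈⟨ +-cong (ι*-cong x (bracket-f₁ g~)) (ι*-cong y (bracket-f₂ g~)) ⟩
    ι x * s /p + ι y * t /p
      ≡⟨ cong₂ (λ m n → ι x * m + ι y * n) (/p≡ι*1/p s) (/p≡ι*1/p t) ⟩
    ι x * (ι (+ s) * 1/p) + ι y * (ι (+ t) * 1/p)
      ≡⟨ solve 5 (λ x s y t i → x :* (s :* i) :+ y :* (t :* i) := (x :* s :+ y :* t) :* i) refl (ι x) (ι (+ s)) (ι y) (ι (+ t)) 1/p ⟩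
    (ι x * ι (+ s) + ι y * ι (+ t)) * 1/p
      ≡⟨ cong (_* 1/p) (cong₂ _+_ (ι-homo-* x (+ s)) (ι-homo-* y (+ t))) ⟨
    (ι (x ℤ.* + s) + ι (y ℤ.* + t)) * 1/p
      ≡⟨ cong (_* 1/p) (ι-homo-+ (x ℤ.* + s) (y ℤ.* + t)) ⟨
    ι (x ℤ.* + s ℤ.+ y ℤ.* + t) * 1/p               ∎
    where open ≈-Reasoning



  ∣⇒·f₁+·f₂≈0 : ∀ {x y} → + p ∣ x → + p ∣ y → ∀ g h → (x ·f₁+ y ·f₂) g h ≈ 0ℚ
  ∣⇒·f₁+·f₂≈0 {x} {y} p∣x p∣y g h = begin
    ι x * f₁ p g h + ι y * f₂ p g h   ≈⟨ +-cong (ι*-cong x (f₁-≈ (~-refl g) (~-refl h))) (ι*-cong y (f₂-≈ (~-refl g) (~-refl h))) ⟩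
    ι x * A /p + ι y * B /p           ≈⟨ +-cong (∣⇒ι*/p≈0 p∣x A) (∣⇒ι*/p≈0 p∣y B) ⟩
    0ℚ + 0ℚ                           ≡⟨ ℚ.+-identityʳ 0ℚ ⟩
    0ℚ                                ∎
    where
    open ≈-Reasoning
    A B : ℕ
    A = u[ g ] ℕ.* s[ h ] ℕ.+ t[ g ] ℕ.* choose₂ s[ h ]
    B = choose₂ t[ g ] ℕ.* s[ h ] ℕ.+ (t[ g ] ℕ.* s[ h ] ℕ.+ u[ g ]) ℕ.* t[ h ]






  Coboundary⇒∣ : ∀ x y {g s t u} → g ~ (s , t , u) → Coboundary (x ·f₁+ y ·f₂) → + p ∣ x ℤ.* + s ℤ.+ y ℤ.* + t
  Coboundary⇒∣ x y {g} g~ F-coboundary =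
    ι*1/p≈0⇒∣ _ (≈-trans (≈-sym (bracket-·f₁+·f₂ x y g~)) (Coboundary⇒bracket≈0 F-coboundary g))

  ·f₁+·f₂-coboundary⇔ : ∀ x y → (Coboundary (x ·f₁+ y ·f₂) → + p ∣ x × + p ∣ y)
                                × (+ p ∣ x → + p ∣ y → Coboundary (x ·f₁+ y ·f₂))
  ·f₁+·f₂-coboundary⇔ x y =
    (λ F-coboundary → ≡.subst (+ p ∣_) (x*1+y*0≡x x y) (Coboundary⇒∣ x y ~-a F-coboundary) ,
                      ≡.subst (+ p ∣_) (x*0+y*1≡y x y) (Coboundary⇒∣ x y ~-b F-coboundary)) ,
    λ p∣x p∣y → ≈0⇒Coboundary (∣⇒·f₁+·f₂≈0 p∣x p∣y)
    where
    x*1+y*0≡x : ∀ x y → x ℤ.* + 1 ℤ.+ y ℤ.* + 0 ≡ x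
    x*1+y*0≡x = ℤ-Solver.solve-∀
    x*0+y*1≡y : ∀ x y → x ℤ.* + 0 ℤ.+ y ℤ.* + 1 ≡ y
    x*0+y*1≡y = ℤ-Solver.solve-∀


  bracket-⊕·f₁+·f₂ : ∀ F x y {g s t u} → g ~ (s , t , u) → ∀ {z} → bracket F g ≈ ι z * 1/p →
                     bracket (F ⊕ (x ·f₁+ y ·f₂)) g ≈ ι (z ℤ.+ (x ℤ.* + s ℤ.+ y ℤ.* + t)) * 1/p
  bracket-⊕·f₁+·f₂ F x y {g} g~ {z} bracket≈z = begin
    bracket (F ⊕ (x ·f₁+ y ·f₂)) g                      ≡⟨ bracket-⊕ F (x ·f₁+ y ·f₂) g ⟩
    bracket F g + bracket (x ·f₁+ y ·f₂) g              ≈⟨ +-cong bracket≈z (bracket-·f₁+·f₂ x y g~) ⟩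
    ι z * 1/p + ι (x ℤ.* + _ ℤ.+ y ℤ.* + _) * 1/p       ≡⟨ ι*1/p-homo-+ z _ ⟩
    ι (z ℤ.+ (x ℤ.* + _ ℤ.+ y ℤ.* + _)) * 1/p           ∎
    where open ≈-Reasoning

  span : ∀ f → Cocycle f → InSpan′ f
  span f f-cocycle = x , y , Extension.bracket≈0⇒Coboundary p p∣choose₂p f′ f′-cocycle
    (vanishes ~-a x (proj₂ (bracket-torsion f f-cocycle a)) (cancel-a x y))
    (vanishes ~-b y (proj₂ (bracket-torsion f f-cocycle b)) (cancel-b x y))
    where
    x y : ℤ
    x = proj₁ (bracket-torsion f f-cocycle a)
    y = proj₁ (bracket-torsion f f-cocycle b)
    f′ : C² p
    f′ = f ⊕ ((ℤ.- x) ·f₁+ (ℤ.- y) ·f₂)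
    f′-cocycle : Cocycle f′
    f′-cocycle = Cocycle-⊕ f ((ℤ.- x) ·f₁+ (ℤ.- y) ·f₂) f-cocycle (·f₁+·f₂-cocycle (ℤ.- x) (ℤ.- y))
    vanishes : ∀ {g s t u} → g ~ (s , t , u) → ∀ z → bracket f g ≡ ι z * 1/p →
               z ℤ.+ (ℤ.- x ℤ.* + s ℤ.+ ℤ.- y ℤ.* + t) ≡ + 0 → bracket f′ g ≈ 0ℚ
    vanishes g~ z bracket≡z z+…≡0 = ≈-trans (bracket-⊕·f₁+·f₂ f (ℤ.- x) (ℤ.- y) g~ {z} (≡⇒≈ bracket≡z))
                                           (≡⇒≈ (≡.trans (cong (λ w → ι w * 1/p) z+…≡0) (ℚ.*-zeroˡ 1/p)))
    cancel-a : ∀ x y → x ℤ.+ (ℤ.- x ℤ.* + 1 ℤ.+ ℤ.- y ℤ.* + 0) ≡ + 0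
    cancel-a = ℤ-Solver.solve-∀
    cancel-b : ∀ x y → y ℤ.+ (ℤ.- x ℤ.* + 0 ℤ.+ ℤ.- y ℤ.* + 1) ≡ + 0
    cancel-b = ℤ-Solver.solve-∀

  span-∣ : ∀ f x y → Coboundary (f ⊕ ((ℤ.- x) ·f₁+ (ℤ.- y) ·f₂)) → ∀ {g s t u} → g ~ (s , t , u) →
           bracket f g ≈ 0ℚ → + p ∣ x ℤ.* + s ℤ.+ y ℤ.* + t
  span-∣ f x y F-coboundary {g} {s} {t} g~ bracket≈0 =
    ≡.subst (+ p ∣_) (negate x y (+ s) (+ t)) (∣m⇒∣-m (ι*1/p≈0⇒∣ _ (≈-trans
      (≈-sym (bracket-⊕·f₁+·f₂ f (ℤ.- x) (ℤ.- y) g~ {+ 0} (≈-trans bracket≈0 (≡⇒≈ (≡.sym (ℚ.*-zeroˡ 1/p))))))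
      (Coboundary⇒bracket≈0 F-coboundary g))))
    where
    negate : ∀ x y s t → ℤ.- (+ 0 ℤ.+ (ℤ.- x ℤ.* s ℤ.+ ℤ.- y ℤ.* t)) ≡ x ℤ.* s ℤ.+ y ℤ.* t
    negate = ℤ-Solver.solve-∀

  shift : ∀ f x y x′ y′ → + p ∣ x ℤ.- x′ → + p ∣ y ℤ.- y′ →
          Coboundary (f ⊕ ((ℤ.- x) ·f₁+ (ℤ.- y) ·f₂)) → Coboundary (f ⊕ ((ℤ.- x′) ·f₁+ (ℤ.- y′) ·f₂))
  shift f x y x′ y′ p∣x-x′ p∣y-y′ F-coboundary =
    Coboundary-resp regroup (Coboundary-⊕ F-coboundary (≈0⇒Coboundary (∣⇒·f₁+·f₂≈0 p∣x-x′ p∣y-y′)))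
    where
    regroup : ∀ g h → ((f ⊕ ((ℤ.- x) ·f₁+ (ℤ.- y) ·f₂)) ⊕ ((x ℤ.- x′) ·f₁+ (y ℤ.- y′) ·f₂)) g h
                      ≈ (f ⊕ ((ℤ.- x′) ·f₁+ (ℤ.- y′) ·f₂)) g h
    regroup g h = ≡⇒≈ (begin
      (F + (ι (ℤ.- x) * A + ι (ℤ.- y) * B)) + (ι (x ℤ.- x′) * A + ι (y ℤ.- y′) * B)
        ≡⟨ cong₂ (λ m n → (F + (m * A + n * B)) + (ι (x ℤ.- x′) * A + ι (y ℤ.- y′) * B)) (ι-homo‿- x) (ι-homo‿- y) ⟩
      (F + (- ι x * A + - ι y * B)) + (ι (x ℤ.- x′) * A + ι (y ℤ.- y′) * B)
        ≡⟨ cong₂ (λ m n → (F + (- ι x * A + - ι y * B)) + (m * A + n * B)) (ι-homo-− x x′) (ι-homo-− y y′) ⟩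
      (F + (- ι x * A + - ι y * B)) + ((ι x - ι x′) * A + (ι y - ι y′) * B)
        ≡⟨ solve 7 (λ F A B x y x′ y′ → (F :+ (:- x :* A :+ :- y :* B)) :+ ((x :- x′) :* A :+ (y :- y′) :* B)
                                        := F :+ (:- x′ :* A :+ :- y′ :* B)) refl F A B (ι x) (ι y) (ι x′) (ι y′) ⟩
      F + (- ι x′ * A + - ι y′ * B)
        ≡⟨ cong₂ (λ m n → F + (m * A + n * B)) (ι-homo‿- x′) (ι-homo‿- y′) ⟨
      F + (ι (ℤ.- x′) * A + ι (ℤ.- y′) * B) ∎)
      where
      open ≡.≡-Reasoning
      F A B : ℚ
      F = f g h
      A = f₁ p g h
      B = f₂ p g h

  rescale : ∀ f h u₁ u₂ k → (∀ x y → h x y ≈ (u₁ ·f₁+ u₂ ·f₂) x y) →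
            Coboundary (f ⊕ ((ℤ.- (k ℤ.* u₁)) ·f₁+ (ℤ.- (k ℤ.* u₂)) ·f₂)) → Coboundary (f ⊕ (ℤ.- k) ⊙ h)
  rescale f h u₁ u₂ k h≈ = Coboundary-resp regroup
    where
    regroup : ∀ x y → (f ⊕ ((ℤ.- (k ℤ.* u₁)) ·f₁+ (ℤ.- (k ℤ.* u₂)) ·f₂)) x y ≈ (f ⊕ (ℤ.- k) ⊙ h) x y
    regroup x y = begin
      f x y + (ι (ℤ.- (k ℤ.* u₁)) * f₁ p x y + ι (ℤ.- (k ℤ.* u₂)) * f₂ p x y)
        ≡⟨ cong₂ (λ m n → f x y + (m * f₁ p x y + n * f₂ p x y)) (ι-k*u u₁) (ι-k*u u₂) ⟩
      f x y + (ι (ℤ.- k) * ι u₁ * f₁ p x y + ι (ℤ.- k) * ι u₂ * f₂ p x y)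
        ≡⟨ solve 6 (λ F A B κ v w → F :+ (κ :* v :* A :+ κ :* w :* B) := F :+ κ :* (v :* A :+ w :* B))
                   refl (f x y) (f₁ p x y) (f₂ p x y) (ι (ℤ.- k)) (ι u₁) (ι u₂) ⟩
      f x y + ι (ℤ.- k) * (u₁ ·f₁+ u₂ ·f₂) x y
        ≈⟨ +-cong (≈-refl {f x y}) (ι*-cong (ℤ.- k) (h≈ x y)) ⟨
      f x y + ι (ℤ.- k) * h x y ∎
      where
      open ≈-Reasoning
      ι-k*u : ∀ u → ι (ℤ.- (k ℤ.* u)) ≡ ι (ℤ.- k) * ι u
      ι-k*u u = ≡.trans (cong ι (ℤ.neg-distribˡ-* k u)) (ι-homo-* (ℤ.- k) u)

  -- For g ~ (s , t , u), the classes f̄ with bracket f g ≈ 0 are those x f̄₁ + y f̄₂ with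
  -- x s + y t ≡ 0 (mod p); the hypotheses say that this line is spanned by h̄ = u₁ f̄₁ + u₂ f̄₂.
  module BracketKernel {g s t u} (g~ : g ~ (s , t , u)) (h : C² p) (u₁ u₂ : ℤ)
           (h≈ : ∀ x y → h x y ≈ (u₁ ·f₁+ u₂ ·f₂) x y)
           (p∣u : + p ∣ u₁ ℤ.* + s ℤ.+ u₂ ℤ.* + t)
           (u-spans : ∀ x y → + p ∣ x ℤ.* + s ℤ.+ y ℤ.* + t →
                      Σ[ k ∈ ℤ ] (+ p ∣ x ℤ.- k ℤ.* u₁) × (+ p ∣ y ℤ.- k ℤ.* u₂)) where

    bracket-h≈0 : bracket h g ≈ 0ℚ
    bracket-h≈0 = ≈-trans (bracket-resp h≈ g) (≈-trans (bracket-·f₁+·f₂ u₁ u₂ g~) (∣⇒ι*/p≈0 p∣u 1))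

    InCyclic′⇒bracket≈0 : ∀ f → InCyclic′ h f → bracket f g ≈ 0ℚ
    InCyclic′⇒bracket≈0 f (k , F-coboundary) = begin
      bracket f g                                            ≡⟨ solve 2 (λ β γ → β := (β :+ γ) :- γ) refl (bracket f g) (ι (ℤ.- k) * bracket h g) ⟩
      (bracket f g + ι (ℤ.- k) * bracket h g) - ι (ℤ.- k) * bracket h g
        ≡⟨ cong (λ r → r - ι (ℤ.- k) * bracket h g) (≡.trans (bracket-⊕ f ((ℤ.- k) ⊙ h) g) (cong (λ r → bracket f g + r) (bracket-⊙ (ℤ.- k) h g))) ⟨
      bracket (f ⊕ (ℤ.- k) ⊙ h) g - ι (ℤ.- k) * bracket h g  ≈⟨ -‿+-cong (Coboundary⇒bracket≈0 F-coboundary g) (ι*-cong (ℤ.- k) bracket-h≈0) ⟩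
      0ℚ - ι (ℤ.- k) * 0ℚ                                    ≡⟨ solve 1 (λ κ → con 0ℚ :- κ :* con 0ℚ := con 0ℚ) refl (ι (ℤ.- k)) ⟩
      0ℚ                                                     ∎
      where open ≈-Reasoning

    bracket≈0⇒InCyclic′ : ∀ f → Cocycle f → bracket f g ≈ 0ℚ → InCyclic′ h f
    bracket≈0⇒InCyclic′ f f-cocycle bracket≈0 = from-span (span f f-cocycle)
      where
      from-k : ∀ x y → Coboundary (f ⊕ ((ℤ.- x) ·f₁+ (ℤ.- y) ·f₂)) →
               Σ[ k ∈ ℤ ] (+ p ∣ x ℤ.- k ℤ.* u₁) × (+ p ∣ y ℤ.- k ℤ.* u₂) → InCyclic′ h f
      from-k x y F-coboundary (k , p∣x-ku₁ , p∣y-ku₂) = k , rescale f h u₁ u₂ k h≈ (shift f x y (k ℤ.* u₁) (k ℤ.* u₂) p∣x-ku₁ p∣y-ku₂ F-coboundary)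
      from-span : InSpan′ f → InCyclic′ h f
      from-span (x , y , F-coboundary) = from-k x y F-coboundary (u-spans x y (span-∣ f x y F-coboundary g~ bracket≈0))

    KernelIs-⟨g,c⟩ : (log₁ log₂ : G p → ℕ) →
                     (∀ M N → log₁ (g ^ᴳ M ∙ c ^ᴳ N) ≡ₚ M) → (∀ M N → log₂ (g ^ᴳ M ∙ c ^ᴳ N) ≡ₚ N) →
                     Kernel′ (⟪_⟫ p (g ∷ c ∷ [])) (InCyclic′ h)
    KernelIs-⟨g,c⟩ log₁ log₂ log₁-w log₂-w f f-cocycle =
      (λ f-coboundaryOn → bracket≈0⇒InCyclic′ f f-cocycle
                            (CoboundaryOn⇒bracket≈0 f-coboundaryOn (base (there (here refl))) (base (here refl)))) ,
      (λ f∈⟨h⟩ → Extension.CoboundaryOn-⟨g,c⟩ p p∣choose₂p f f-cocycle g (InCyclic′⇒bracket≈0 f f∈⟨h⟩)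
                   log₁ log₂ log₁-w log₂-w)

module Main (p : ℕ) .{{_ : NonZero p}} (p∣choose₂p : p ∣ℕ choose₂ p) where

  open import Data.List using (_∷_; [])
  open import Data.List.Relation.Unary.Any using (here; there)
  open import Data.Nat as ℕ using (_%_; _*_)
  import Data.Nat.Properties as ℕ
  open import Data.Nat.DivMod using (m≡m%n+[m/n]*n)
  import Data.Nat.Tactic.RingSolver as ℕ-Solver
  open import Data.Integer as ℤ using (ℤ; +_)
  import Data.Integer.Properties as ℤ
  open import Data.Integer.Divisibility using (_∣_)
  import Data.Integer.Divisibility.Signed as Signed
  import Data.Integer.Tactic.RingSolver as ℤ-Solver
  open import Data.Rational using (0ℚ; 1ℚ)
  open import Data.Rational.Solver using (module +-*-Solver)
  open import Data.Product using (Σ-syntax; _×_; _,_; proj₁; proj₂)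
  open import Relation.Binary.PropositionalEquality as ≡ using (_≡_; refl; cong)

  open ModularArithmetic p
  open Model p p∣choose₂p
  open Cochains p p∣choose₂p
  open +-*-Solver
  open Kernels p p∣choose₂p
  open ℚ/ℤ

  ≈⇒≈ℚ/ℤ : ∀ {x y} → x ≈ y → _≈ℚ/ℤ_ p x y
  ≈⇒≈ℚ/ℤ (z , x-y≡z) = z , x-y≡z

  ≈ℚ/ℤ⇒≈ : ∀ {x y} → _≈ℚ/ℤ_ p x y → x ≈ y
  ≈ℚ/ℤ⇒≈ (z , x-y≡z) = z , x-y≡z

  IsCocycle⇒Cocycle : ∀ f → IsCocycle p f → Cocycle f
  IsCocycle⇒Cocycle f f-cocycle g h k = ≈ℚ/ℤ⇒≈ (f-cocycle g h k)

  Cocycle⇒IsCocycle : ∀ f → Cocycle f → IsCocycle p f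
  Cocycle⇒IsCocycle f f-cocycle g h k = ≈⇒≈ℚ/ℤ (f-cocycle g h k)

  IsCoboundary⇒Coboundary : ∀ f → IsCoboundary p f → Coboundary f
  IsCoboundary⇒Coboundary f (φ , f≈δφ) = φ , λ x y → ≈ℚ/ℤ⇒≈ (f≈δφ x y)

  Coboundary⇒IsCoboundary : ∀ f → Coboundary f → IsCoboundary p f
  Coboundary⇒IsCoboundary f (φ , f≈δφ) = φ , λ x y → ≈⇒≈ℚ/ℤ (f≈δφ x y)

  CoboundaryOn⇒CoboundaryOn′ : ∀ {H} f → CoboundaryOn p H f → CoboundaryOn′ H f
  CoboundaryOn⇒CoboundaryOn′ f (φ , f≈δφ) = φ , λ {x} {y} Hx Hy → ≈ℚ/ℤ⇒≈ (f≈δφ x y Hx Hy)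

  CoboundaryOn′⇒CoboundaryOn : ∀ {H} f → CoboundaryOn′ H f → CoboundaryOn p H f
  CoboundaryOn′⇒CoboundaryOn f (φ , f≈δφ) = φ , λ x y Hx Hy → ≈⇒≈ℚ/ℤ (f≈δφ Hx Hy)

  Kernel′⇒KernelIs : ∀ {H P P′} → (∀ f → P′ f → P f) → (∀ f → P f → P′ f) → Kernel′ H P′ → KernelIs p H P
  Kernel′⇒KernelIs {H} {P} {P′} P′⇒P P⇒P′ kernel f f-cocycle =
    (λ f-coboundaryOn → P′⇒P f (proj₁ kernel-f (CoboundaryOn⇒CoboundaryOn′ f f-coboundaryOn))) ,
    (λ Pf → CoboundaryOn′⇒CoboundaryOn f (proj₂ kernel-f (P⇒P′ f Pf)))
    where
    kernel-f : (CoboundaryOn′ H f → P′ f) × (P′ f → CoboundaryOn′ H f)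
    kernel-f = kernel f (IsCocycle⇒Cocycle f f-cocycle)

  InSpan′⇒InSpan₂ : ∀ f → InSpan′ f → InSpan₂ p (f₁ p) (f₂ p) f
  InSpan′⇒InSpan₂ f (x , y , F-coboundary) = x , y , Coboundary⇒IsCoboundary (f ⊕ ((ℤ.- x) ·f₁+ (ℤ.- y) ·f₂)) F-coboundary

  InSpan₂⇒InSpan′ : ∀ f → InSpan₂ p (f₁ p) (f₂ p) f → InSpan′ f
  InSpan₂⇒InSpan′ f (x , y , F-coboundary) = x , y , IsCoboundary⇒Coboundary (f ⊕ ((ℤ.- x) ·f₁+ (ℤ.- y) ·f₂)) F-coboundary

  span₂ : ∀ f → IsCocycle p f → InSpan₂ p (f₁ p) (f₂ p) f
  span₂ f f-cocycle = InSpan′⇒InSpan₂ f (span f (IsCocycle⇒Cocycle f f-cocycle))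

  basis : ∀ x y → (IsCoboundary p (x ·f₁+ y ·f₂) → + p ∣ x × + p ∣ y) × (+ p ∣ x × + p ∣ y → IsCoboundary p (x ·f₁+ y ·f₂))
  basis x y =
    (λ F-coboundary → let p∣x , p∣y = proj₁ (·f₁+·f₂-coboundary⇔ x y) (IsCoboundary⇒Coboundary (x ·f₁+ y ·f₂) F-coboundary)
                      in Signed.∣⇒∣ᵤ p∣x , Signed.∣⇒∣ᵤ p∣y) ,
    (λ (p∣x , p∣y) → Coboundary⇒IsCoboundary (x ·f₁+ y ·f₂) (proj₂ (·f₁+·f₂-coboundary⇔ x y) (Signed.∣ᵤ⇒∣ p∣x) (Signed.∣ᵤ⇒∣ p∣y)))

  kernel-everything : ∀ {H} → (∀ f → Cocycle f → CoboundaryOn′ H f) → KernelIs p H (InSpan₂ p (f₁ p) (f₂ p))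
  kernel-everything {H} splits = Kernel′⇒KernelIs {P′ = InSpan′} InSpan′⇒InSpan₂ InSpan₂⇒InSpan′
    (λ f f-cocycle → (λ _ → span f f-cocycle) , (λ _ → splits f f-cocycle))

  cyclic-splits : ∀ g (log : G p → ℕ) → (∀ M → log (g ^ᴳ M) ≡ₚ M) → ∀ f → Cocycle f → CoboundaryOn′ (⟪_⟫ p (g ∷ [])) f
  cyclic-splits g log log-^ f f-cocycle = Extension.CoboundaryOn-cyclic p p∣choose₂p f f-cocycle g log log-^

  kernel-Triv : KernelIs p (Triv p) (InSpan₂ p (f₁ p) (f₂ p))
  kernel-Triv = kernel-everything λ f f-cocycle →
    CoboundaryOn′-mono (⟪⟫-ind (⟪_⟫ p (c ∷ [])) one mul (λ ())) (cyclic-splits c u[_] (λ M → proj₂ (proj₂ (~-c^ M))) f f-cocycle)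

  kernel-Z : KernelIs p (Defs.Z p) (InSpan₂ p (f₁ p) (f₂ p))
  kernel-Z = kernel-everything (cyclic-splits c u[_] (λ M → proj₂ (proj₂ (~-c^ M))))

  kernel-Hc : ∀ i → KernelIs p (Hc p i) (InSpan₂ p (f₁ p) (f₂ p))
  kernel-Hc i = kernel-everything (cyclic-splits (a ∙ b ^ᴳ i) s[_] (λ M → proj₁ (~-[ab^]^ i M)))

  kernel-Hp : KernelIs p (Hp p) (InSpan₂ p (f₁ p) (f₂ p))
  kernel-Hp = kernel-everything (cyclic-splits b t[_] (λ M → proj₁ (proj₂ (~-b^ M))))

  InCyclic′⇒InCyclic : ∀ h f → InCyclic′ h f → InCyclic p h f
  InCyclic′⇒InCyclic h f (k , F-coboundary) = k , Coboundary⇒IsCoboundary (f ⊕ (ℤ.- k) ⊙ h) F-coboundary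

  InCyclic⇒InCyclic′ : ∀ h f → InCyclic p h f → InCyclic′ h f
  InCyclic⇒InCyclic′ h f (k , F-coboundary) = k , IsCoboundary⇒Coboundary (f ⊕ (ℤ.- k) ⊙ h) F-coboundary

  p∣0 : + p Signed.∣ + 0
  p∣0 = Signed.divides (+ 0) refl

  p∣1-ij : ∀ i j → (i * j) % p ≡ 1 → + p Signed.∣ + 1 ℤ.- + i ℤ.* + j
  p∣1-ij i j ij%p≡1 = Signed.divides (ℤ.- + r) (begin
    + 1 ℤ.- + i ℤ.* + j              ≡⟨ cong (λ z → + 1 ℤ.- z) (ℤ.pos-* i j) ⟨
    + 1 ℤ.- + (i * j)                ≡⟨ cong (λ n → + 1 ℤ.- + n) (≡.trans (m≡m%n+[m/n]*n (i * j) p) (cong (ℕ._+ r * p) ij%p≡1)) ⟩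
    + 1 ℤ.- + (1 ℕ.+ r * p)          ≡⟨ cong (λ z → + 1 ℤ.- (+ 1 ℤ.+ z)) (ℤ.pos-* r p) ⟩
    + 1 ℤ.- (+ 1 ℤ.+ + r ℤ.* + p)    ≡⟨ cancel (+ r) (+ p) ⟩
    ℤ.- + r ℤ.* + p                  ∎)
    where
    open ≡.≡-Reasoning
    r : ℕ
    r = (i * j) ℕ./ p
    cancel : ∀ r p → + 1 ℤ.- (+ 1 ℤ.+ r ℤ.* p) ≡ ℤ.- r ℤ.* p
    cancel = ℤ-Solver.solve-∀

  -- N for x = (a b^i)^M c^N, read off as u - i·choose₂ s (mod p) without truncated subtraction.
  log₂ⁱ : ℕ → G p → ℕ
  log₂ⁱ i x = u[ x ] ℕ.+ (p ℕ.∸ 1) * (i * choose₂ s[ x ])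

  log₂ⁱ-w : ∀ i M N → log₂ⁱ i ((a ∙ b ^ᴳ i) ^ᴳ M ∙ c ^ᴳ N) ≡ₚ N
  log₂ⁱ-w i M N = ≡.trans
    (+-congₚ (proj₂ (proj₂ w~)) (*-congₚ (≡ₚ-refl (p ℕ.∸ 1)) (*-congₚ (≡ₚ-refl i) (choose₂-congₚ p∣choose₂p (proj₁ w~)))))
    (≡.trans (≡⇒≡ₚ (≡.trans (regroup (i * choose₂ M) N (p ℕ.∸ 1)) (cong (λ n → N ℕ.+ i * choose₂ M * n) (ℕ.suc-pred p))))
             (+*p≡ₚ N (i * choose₂ M)))
    where
    w~ : (a ∙ b ^ᴳ i) ^ᴳ M ∙ c ^ᴳ N ~ (M , M * i , i * choose₂ M ℕ.+ N)
    w~ = ~-[ab^]^∙c^ i M N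
    regroup : ∀ A N q → A ℕ.+ N ℕ.+ q * A ≡ N ℕ.+ A * (1 ℕ.+ q)
    regroup = ℕ-Solver.solve-∀

  kernel-H′₀ : KernelIs p (H′c p 0) (InCyclic p (f₂ p))
  kernel-H′₀ = Kernel′⇒KernelIs (InCyclic′⇒InCyclic (f₂ p)) (InCyclic⇒InCyclic′ (f₂ p))
    (KernelIs-⟨g,c⟩ s[_] (log₂ⁱ 0) (λ M N → proj₁ (~-[ab^]^∙c^ 0 M N)) (log₂ⁱ-w 0))
    where
    u-spans : ∀ x y → + p Signed.∣ x ℤ.* + 1 ℤ.+ y ℤ.* + 0 → Σ[ k ∈ ℤ ] (+ p Signed.∣ x ℤ.- k ℤ.* + 0) × (+ p Signed.∣ y ℤ.- k ℤ.* + 1)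
    u-spans x y p∣x = y , ≡.subst (+ p Signed.∣_) (e₁ x y) p∣x , ≡.subst (+ p Signed.∣_) (≡.sym (e₂ y)) p∣0
      where
      e₁ : ∀ x y → x ℤ.* + 1 ℤ.+ y ℤ.* + 0 ≡ x ℤ.- y ℤ.* + 0
      e₁ = ℤ-Solver.solve-∀
      e₂ : ∀ y → y ℤ.- y ℤ.* + 1 ≡ + 0
      e₂ = ℤ-Solver.solve-∀
    f₂≈ : ∀ x y → f₂ p x y ≈ (+ 0 ·f₁+ + 1 ·f₂) x y
    f₂≈ x y = ≡⇒≈ (solve 2 (λ A B → B := con 0ℚ :* A :+ con 1ℚ :* B) refl (f₁ p x y) (f₂ p x y))
    open BracketKernel (~-ab^ 0) (f₂ p) (+ 0) (+ 1) f₂≈ p∣0 u-spans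

  kernel-H′ᵢ : ∀ i j → (i * j) % p ≡ 1 →
               KernelIs p (H′c p i) (InCyclic p (f₁ p ⊕ (ℤ.- (+ j)) ⊙ f₂ p))
  kernel-H′ᵢ i j ij%p≡1 = Kernel′⇒KernelIs (InCyclic′⇒InCyclic h) (InCyclic⇒InCyclic′ h)
    (KernelIs-⟨g,c⟩ s[_] (log₂ⁱ i) (λ M N → proj₁ (~-[ab^]^∙c^ i M N)) (log₂ⁱ-w i))
    where
    h : C² p
    h = f₁ p ⊕ (ℤ.- (+ j)) ⊙ f₂ p
    h≈ : ∀ x y → h x y ≈ (+ 1 ·f₁+ ℤ.- (+ j) ·f₂) x y
    h≈ x y = ≡⇒≈ (solve 3 (λ A B κ → A :+ κ :* B := con 1ℚ :* A :+ κ :* B) refl (f₁ p x y) (f₂ p x y) (ι (ℤ.- (+ j))))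
    p∣u : + p Signed.∣ + 1 ℤ.* + 1 ℤ.+ ℤ.- (+ j) ℤ.* + i
    p∣u = ≡.subst (+ p Signed.∣_) (e₀ (+ i) (+ j)) (p∣1-ij i j ij%p≡1)
      where
      e₀ : ∀ i j → + 1 ℤ.- i ℤ.* j ≡ + 1 ℤ.* + 1 ℤ.+ ℤ.- j ℤ.* i
      e₀ = ℤ-Solver.solve-∀
    u-spans : ∀ x y → + p Signed.∣ x ℤ.* + 1 ℤ.+ y ℤ.* + i →
              Σ[ k ∈ ℤ ] (+ p Signed.∣ x ℤ.- k ℤ.* + 1) × (+ p Signed.∣ y ℤ.- k ℤ.* ℤ.- (+ j))
    u-spans x y p∣x+yi = x , ≡.subst (+ p Signed.∣_) (≡.sym (e₁ x)) p∣0 ,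
      ≡.subst (+ p Signed.∣_) (≡.sym (e₂ x y (+ i) (+ j)))
        (Signed.∣m∣n⇒∣m+n (Signed.∣n⇒∣m*n (+ j) p∣x+yi) (Signed.∣n⇒∣m*n y (p∣1-ij i j ij%p≡1)))
      where
      e₁ : ∀ x → x ℤ.- x ℤ.* + 1 ≡ + 0
      e₁ = ℤ-Solver.solve-∀
      e₂ : ∀ x y i j → y ℤ.- x ℤ.* ℤ.- j ≡ j ℤ.* (x ℤ.* + 1 ℤ.+ y ℤ.* i) ℤ.+ y ℤ.* (+ 1 ℤ.- i ℤ.* j)
      e₂ = ℤ-Solver.solve-∀
    open BracketKernel (~-ab^ i) h (+ 1) (ℤ.- (+ j)) h≈ p∣u u-spans

  kernel-H′ₚ : KernelIs p (H′p p) (InCyclic p (f₁ p))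
  kernel-H′ₚ = Kernel′⇒KernelIs (InCyclic′⇒InCyclic (f₁ p)) (InCyclic⇒InCyclic′ (f₁ p))
    (KernelIs-⟨g,c⟩ t[_] u[_] (λ M N → proj₁ (proj₂ (~-b^∙c^ M N))) (λ M N → proj₂ (proj₂ (~-b^∙c^ M N))))
    where
    f₁≈ : ∀ x y → f₁ p x y ≈ (+ 1 ·f₁+ + 0 ·f₂) x y
    f₁≈ x y = ≡⇒≈ (solve 2 (λ A B → A := con 1ℚ :* A :+ con 0ℚ :* B) refl (f₁ p x y) (f₂ p x y))
    u-spans : ∀ x y → + p Signed.∣ x ℤ.* + 0 ℤ.+ y ℤ.* + 1 →
              Σ[ k ∈ ℤ ] (+ p Signed.∣ x ℤ.- k ℤ.* + 1) × (+ p Signed.∣ y ℤ.- k ℤ.* + 0)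
    u-spans x y p∣y = x , ≡.subst (+ p Signed.∣_) (≡.sym (e₁ x)) p∣0 , ≡.subst (+ p Signed.∣_) (e₂ x y) p∣y
      where
      e₁ : ∀ x → x ℤ.- x ℤ.* + 1 ≡ + 0
      e₁ = ℤ-Solver.solve-∀
      e₂ : ∀ x y → x ℤ.* + 0 ℤ.+ y ℤ.* + 1 ≡ y ℤ.- x ℤ.* + 0
      e₂ = ℤ-Solver.solve-∀
    open BracketKernel ~-b (f₁ p) (+ 1) (+ 0) f₁≈ p∣0 u-spans

  kernel-G : KernelIs p (H′G p) (IsCoboundary p)
  kernel-G = Kernel′⇒KernelIs Coboundary⇒IsCoboundary IsCoboundary⇒Coboundary λ f f-cocycle →
    (λ f-coboundaryOn → Extension.bracket≈0⇒Coboundary p p∣choose₂p f f-cocycle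
                          (CoboundaryOn⇒bracket≈0 f-coboundaryOn c∈H′G (base (here refl)))
                          (CoboundaryOn⇒bracket≈0 f-coboundaryOn c∈H′G (base (there (here refl))))) ,
    Coboundary⇒CoboundaryOn′
    where
    c∈H′G : H′G p c
    c∈H′G = base (there (there (here refl)))

open import Data.Nat using (_≤_; _<_; _*_; _%_)
open import Data.Nat.Primality using (Prime)
open import Data.Integer as ℤ using (ℤ; +_)
open import Data.Integer.Divisibility using (_∣_)
open import Data.Product using (_×_; _,_)
open import Relation.Binary.PropositionalEquality using (_≡_)
open Defs using (_⊕_; _⊙_; Z)

lemma2p5 : (p : ℕ) .{{_ : NonZero p}} → Prime p → 3 ≤ p →
  -- f₁, f₂ are 2-cocycles
  (IsCocycle p (f₁ p) × IsCocycle p (f₂ p))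
  -- H²(G,Q/Z) = ⟨ f̄₁ , f̄₂ ⟩
  × (∀ f → IsCocycle p f → InSpan₂ p (f₁ p) (f₂ p) f)
  -- ... ≃ (Z/pZ)²  with basis f̄₁, f̄₂
  × (∀ (x y : ℤ) → (IsCoboundary p (_⊕_ p (_⊙_ p x (f₁ p)) (_⊙_ p y (f₂ p))) → ((+ p) ∣ x × (+ p) ∣ y))
                 × (((+ p) ∣ x × (+ p) ∣ y) → IsCoboundary p (_⊕_ p (_⊙_ p x (f₁ p)) (_⊙_ p y (f₂ p)))))
  -- kernels of restriction
  × KernelIs p (Triv p) (InSpan₂ p (f₁ p) (f₂ p))
  × KernelIs p (Z p) (InSpan₂ p (f₁ p) (f₂ p))
  × (∀ i → i < p → KernelIs p (Hc p i) (InSpan₂ p (f₁ p) (f₂ p)))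
  × KernelIs p (Hp p) (InSpan₂ p (f₁ p) (f₂ p))
  × KernelIs p (H′c p 0) (InCyclic p (f₂ p))
  × (∀ i j → 1 ≤ i → i < p → (i * j) % p ≡ 1 →
       KernelIs p (H′c p i) (InCyclic p (_⊕_ p (f₁ p) (_⊙_ p (ℤ.- (+ j)) (f₂ p)))))
  × KernelIs p (H′p p) (InCyclic p (f₁ p))
  × KernelIs p (H′G p) (IsCoboundary p)
lemma2p5 p p-prime 3≤p =
  (Cocycle⇒IsCocycle (f₁ p) f₁-cocycle , Cocycle⇒IsCocycle (f₂ p) f₂-cocycle) ,
  span₂ , basis ,
  kernel-Triv , kernel-Z , (λ i _ → kernel-Hc i) , kernel-Hp ,
  kernel-H′₀ , (λ i j _ _ → kernel-H′ᵢ i j) , kernel-H′ₚ , kernel-G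
  where
  p∣choose₂p : p ∣ℕ choose₂ p
  p∣choose₂p = odd⇒∣choose₂ (prime⇒odd p-prime 3≤p)
  open Cochains p p∣choose₂p using (f₁-cocycle; f₂-cocycle)
  open Main p p∣choose₂p
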